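{- Let $k \ge 2$ and $n \ge 1$ be integers, and let $R_k(n)$ denote the number of reduced $k$-by-$n$ Latin rectangles on $\{1,\dots,n\}$. Let $m=k-1$. For a vector $t=(t_\varepsilon)_{\varepsilon\in\{0,1\}^m}$ of integers and a nonempty $B\subseteq\{1,\dots,m\}$ put \[ f_B(t)=\sum_{\varepsilon\in\{0,1\}^m:\ \varepsilon_i=0\text{ for all } i\in B} t_\varepsilon, \] and define \[ g_k(t)=\sum_{\pi} \Big(\prod_{B\in\pi}(-1)^{|B|-1}(|B|-1)!\Big)\prod_{B\in\pi} f_B(t), \] where $\pi$ ranges over all set partitions of $\{1,\dots,m\}$. Write $\mathbf 1=(1,\dots,1)\in\{0,1\}^m$, let $e_\varepsilon$ denote the unit vector indexed by $\varepsilon$, and let $|\varepsilon|$ be the number of $1$'s in $\varepsilon$. Then \[ R_k(n)=\sum_{s}(-1)^{\sum_{\varepsilon}|\varepsilon|\, s_\varepsilon}\binom{n}{(s_\varepsilon)_{\varepsilon\in\{0,1\}^m}}\prod_{\varepsilon\in\{0,1\}^m} g_k\big(s-e_\varepsilon+e_{\mathbf 1}\big)^{s_\varepsilon}, \] where the sum is over all vectors $s=(s_\varepsilon)_{\varepsilon\in\{0,1\}^m}$ of nonnegative integers with $\sum_\varepsilon s_\varepsilon=n$, the binomial symbol is the multinomial coefficient, and the convention $x^0=1$ (including $0^0=1$) is used.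
   Context: A $k$-by-$n$ Latin rectangle on $\{1,\dots,n\}$ is a $k\times n$ matrix with entries in $\{1,\dots,n\}$ such that no row and no column contains a repeated entry. It is reduced if its first row is $1,2,\dots,n$ in order. Note that for $\varepsilon=\mathbf 1$ the vector $s-e_\varepsilon+e_{\mathbf 1}$ equals $s$. -}

module Defs where

open import Data.Bool using (Bool; true; false; if_then_else_)
open import Data.Bool.Properties using () renaming (_≟_ to _≟B_)
open import Data.Nat as ℕ using (ℕ; zero; suc; _∸_; _!; NonZero)
open import Data.Nat.Properties using (_!≢0; m*n≢0)
import Data.Nat.DivMod as ℕD
open import Data.Fin as Fin using (Fin)
open import Data.Fin.Properties using (all?) renaming (_≟_ to _≟F_)
open import Data.Integer as ℤ using (ℤ; +_; -1ℤ; _^_)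
open import Data.List as List using (List; []; _∷_; _++_; map; concatMap; filter; length; upTo; allFin)
open import Data.Vec as Vec using (Vec; []; _∷_; lookup)
open import Data.Vec.Properties using (≡-dec)
open import Relation.Binary.PropositionalEquality using (_≡_)
open import Relation.Nullary using (Dec; yes; no)
open import Relation.Nullary.Decidable using (_×-dec_; _→-dec_)
open import Data.Product using (_×_)
open import Data.Nat.ListAction using () renaming (sum to sumℕ)

-- A k-by-n matrix with entries in {1,…,n} is represented as
-- Vec (Vec (Fin n) n) k  (row i, column j entry = lookup (lookup L i) j),
-- with the symbol set {1,…,n} represented by Fin n (symbol j+1 ↔ j).

Matrix : ℕ → ℕ → Set
Matrix k n = Vec (Vec (Fin n) n) k

entry : ∀ {k n} → Matrix k n → Fin k → Fin n → Fin n
entry L i j = lookup (lookup L i) j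

RowsDistinct : ∀ {k n} → Matrix k n → Set
RowsDistinct {k} {n} L = ∀ (i : Fin k) (j j′ : Fin n) → entry L i j ≡ entry L i j′ → j ≡ j′

ColsDistinct : ∀ {k n} → Matrix k n → Set
ColsDistinct {k} {n} L = ∀ (j : Fin n) (i i′ : Fin k) → entry L i j ≡ entry L i′ j → i ≡ i′

IsLatin : ∀ {k n} → Matrix k n → Set
IsLatin L = RowsDistinct L × ColsDistinct L

-- reduced: the first row is 1,2,…,n in order (k = suc m so a first row exists)
FirstRowId : ∀ {m n} → Matrix (suc m) n → Set
FirstRowId {m} {n} L = ∀ (j : Fin n) → entry L Fin.zero j ≡ j

IsReducedLatin : ∀ {m n} → Matrix (suc m) n → Set
IsReducedLatin L = IsLatin L × FirstRowId L

isReducedLatin? : ∀ {m n} (L : Matrix (suc m) n) → Dec (IsReducedLatin L)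
isReducedLatin? L =
  (all? (λ i → all? (λ j → all? (λ j′ → (entry L i j ≟F entry L i j′) →-dec (j ≟F j′))))
   ×-dec all? (λ j → all? (λ i → all? (λ i′ → (entry L i j ≟F entry L i′ j) →-dec (i ≟F i′)))))
  ×-dec all? (λ j → entry L Fin.zero j ≟F j)

allVecs : ∀ {a} {A : Set a} → List A → (n : ℕ) → List (Vec A n)
allVecs xs zero    = [] ∷ []
allVecs xs (suc n) = concatMap (λ x → map (x ∷_) (allVecs xs n)) xs

allMatrices : (k n : ℕ) → List (Matrix k n)
allMatrices k n = allVecs (allVecs (allFin n) n) k

R : (k n : ℕ) → ℕ
R zero    n = 0   -- not used (k ≥ 2 in the theorem)
R (suc m) n = length (filter isReducedLatin? (allMatrices (suc m) n))

-- The cube {0,1}^m, with ε_i = 1 ↔ true.  Subsets B ⊆ {1,…,m} are also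
-- represented as Vec Bool m (characteristic vectors).

cube : (m : ℕ) → List (Vec Bool m)
cube m = allVecs (true ∷ false ∷ []) m

Σε : ∀ {m} → (Vec Bool m → ℤ) → ℤ
Σε {m} f = List.foldr (λ ε acc → f ε ℤ.+ acc) (+ 0) (cube m)

Πε : ∀ {m} → (Vec Bool m → ℤ) → ℤ
Πε {m} f = List.foldr (λ ε acc → f ε ℤ.* acc) (+ 1) (cube m)

ones : ∀ {m} → Vec Bool m → ℕ
ones []           = 0
ones (true ∷ v)   = suc (ones v)
ones (false ∷ v)  = ones v

𝟏 : ∀ {m} → Vec Bool m
𝟏 {m} = Vec.replicate m true

ZeroOn : ∀ {m} → Vec Bool m → Vec Bool m → Bool
ZeroOn []          []           = true
ZeroOn (true ∷ B)  (true ∷ ε)   = false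
ZeroOn (true ∷ B)  (false ∷ ε)  = ZeroOn B ε
ZeroOn (false ∷ B) (_ ∷ ε)      = ZeroOn B ε

f : ∀ {m} → Vec Bool m → (Vec Bool m → ℤ) → ℤ
f B t = Σε (λ ε → if ZeroOn B ε then t ε else + 0)

-- Set partitions of {1,…,m}, as lists of blocks (each block a
-- characteristic vector).  Standard recursion: a partition of
-- {1,…,m+1} is obtained from a unique partition of {2,…,m+1} by either
-- adding {1} as a new block or inserting 1 into exactly one block.
-- Each set partition occurs exactly once in `partitions m`.

addToOne : ∀ {m} → List (Vec Bool m) → List (List (Vec Bool (suc m)))
addToOne []       = []
addToOne (B ∷ Bs) =
  ((true ∷ B) ∷ map (false ∷_) Bs) ∷ map ((false ∷ B) ∷_) (addToOne Bs)

partitions : (m : ℕ) → List (List (Vec Bool m))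
partitions zero    = [] ∷ []
partitions (suc m) = concatMap
  (λ π → ((true ∷ Vec.replicate m false) ∷ map (false ∷_) π) ∷ addToOne π)
  (partitions m)

Πblocks : ∀ {m} → List (Vec Bool m) → (Vec Bool m → ℤ) → ℤ
Πblocks π h = List.foldr (λ B acc → h B ℤ.* acc) (+ 1) π

-- g_k(t) with k = m + 1
g : ∀ {m} → (Vec Bool m → ℤ) → ℤ
g {m} t = List.foldr (λ π acc →
    (Πblocks π (λ B → (-1ℤ ^ (ones B ∸ 1)) ℤ.* (+ ((ones B ∸ 1) !))))
      ℤ.* Πblocks π (λ B → f B t) ℤ.+ acc)
  (+ 0) (partitions m)

-- Vectors s = (s_ε) of nonnegative integers with Σ_ε s_ε = n, listed
-- (each exactly once) by recursion on m: s splits by the first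
-- coordinate of ε into two vectors with sums a and n ∸ a.

comps : (m n : ℕ) → List (Vec Bool m → ℕ)
comps zero    n = (λ _ → n) ∷ []
comps (suc m) n = concatMap (λ a →
    concatMap (λ s₀ → map (λ s₁ → λ where
        (false ∷ ε) → s₀ ε
        (true  ∷ ε) → s₁ ε)
      (comps m (n ∸ a)))
    (comps m a))
  (upTo (suc n))

prodFact : List ℕ → ℕ
prodFact []       = 1
prodFact (x ∷ xs) = x ! ℕ.* prodFact xs

prodFact≢0 : ∀ xs → NonZero (prodFact xs)
prodFact≢0 []       = _
prodFact≢0 (x ∷ xs) = m*n≢0 (x !) (prodFact xs) {{x !≢0}} {{prodFact≢0 xs}}

multinomial : ∀ {m} → ℕ → (Vec Bool m → ℕ) → ℕ
multinomial {m} n s =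
  ℕD._/_ (n !) (prodFact (map s (cube m))) {{prodFact≢0 (map s (cube m))}}

shift : ∀ {m} → (Vec Bool m → ℕ) → Vec Bool m → (Vec Bool m → ℤ)
shift {m} s ε δ =
  (+ s δ ℤ.- ind (≡-dec _≟B_ δ ε)) ℤ.+ ind (≡-dec _≟B_ δ 𝟏)
  where
  ind : ∀ {P : Set} → Dec P → ℤ
  ind (yes _) = + 1
  ind (no _)  = + 0

-- the right-hand side (k = m + 1)
rhs : (m n : ℕ) → ℤ
rhs m n = List.foldr (λ s acc →
    (-1ℤ ^ sumℕ (map (λ ε → ones ε ℕ.* s ε) (cube m)))
      ℤ.* (+ multinomial n s)
      ℤ.* Πε (λ ε → g (shift s ε) ^ s ε)
    ℤ.+ acc)
  (+ 0) (comps m n)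

-- A reduced rectangle is the identity row above m rows that are onto (hence
-- permutations) and whose columns, with their index j on top, are injective.
-- Writing "row i is onto" as ∏_x (1 − [x is missing from row i]) and expanding
-- by inclusion–exclusion chooses for every letter x a set E x ∈ {0,1}^m of rows
-- declared to miss x, with sign (−1)^|E x|. For fixed E the sum over the rows
-- factorises over the columns: column j must be an injective word of length m
-- that avoids j and avoids x at the rows in E x. Möbius inversion on the lattice
-- of set partitions counts these words as the partition sum g of the numbers f_B
-- of letters allowed at all rows of a block B; these numbers only depend on the
-- counts s_ε = #{x | E x = ε}, and column j turns one letter of type E j into
-- one of type 𝟏, which gives g(s − e_{E j} + e_𝟏). Grouping the E by their
-- counts s produces the multinomial coefficient.

module Submission where

open import Defs
open import Data.Nat using (ℕ; suc; _≤_)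
open import Data.Integer using (+_)
open import Relation.Binary.PropositionalEquality using (_≡_)

open import Data.Bool using (Bool; true; false; if_then_else_; not; _∧_; _∨_; T)
open import Data.Bool.Properties using (T-∧; ∧-assoc; ∧-comm; ∧-zeroʳ; ∧-identityʳ) renaming (_≟_ to _≟B_)
open import Data.Nat as ℕ using (zero; _∸_; _!)
import Data.Nat.Properties as ℕP
import Data.Nat.DivMod as ℕD
import Data.Nat.Solver as NatSolver
module NS = NatSolver.+-*-Solver
open import Data.Fin as Fin using (Fin)
open import Data.Fin.Properties using (suc-injective; any?; all?; punchOut-injective; injective⇒≤) renaming (_≟_ to _≟F_)
open import Data.Integer as ℤ using (ℤ; -1ℤ; _+_; _*_; -_; _-_; _^_)
import Data.Integer.Properties as ℤP
open import Data.List as List using (List; []; _∷_; _++_; map; concatMap; foldr; allFin; tabulate; upTo; applyUpTo; filter; length)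
open import Data.List.Relation.Unary.All as All using (All; []; _∷_)
open import Data.List.Relation.Unary.All.Properties using (map⁺; concat⁺; applyUpTo⁺₁)
import Data.List.Properties as LP
open import Data.Vec as Vec using (Vec; []; _∷_; lookup)
open import Data.Vec.Properties using (≡-dec; lookup-replicate; lookup-map; lookup-allFin; tabulate∘lookup; tabulate-cong)
open import Relation.Binary.Definitions using (DecidableEquality)
open import Data.Product using (_×_; _,_; proj₁; proj₂; ∃)
open import Relation.Binary.PropositionalEquality using (_≢_; refl; sym; trans; cong; cong₂; subst; module ≡-Reasoning)
open import Relation.Nullary using (Dec; yes; no; does; contradiction)
open import Relation.Nullary.Decidable using (T?; _×-dec_; does-⇔)
open import Function.Bundles using (Equivalence; _⇔_; mk⇔)
open import Data.Nat.ListAction using () renaming (sum to sumℕ)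
open import Data.Integer.Solver using (module +-*-Solver)
open +-*-Solver using (solve; con; _:+_; _:*_; :-_; _:-_; _:=_)

-- Finite sums and products

∑ ∏ : ∀ {a} {A : Set a} → List A → (A → ℤ) → ℤ
∑ xs h = foldr (λ x acc → h x + acc) (+ 0) xs
∏ xs h = foldr (λ x acc → h x * acc) (+ 1) xs

∑ᶠ ∏ᶠ : (n : ℕ) → (Fin n → ℤ) → ℤ
∑ᶠ zero    h = + 0
∑ᶠ (suc n) h = h Fin.zero + ∑ᶠ n (λ i → h (Fin.suc i))
∏ᶠ zero    h = + 1
∏ᶠ (suc n) h = h Fin.zero * ∏ᶠ n (λ i → h (Fin.suc i))

module _ {a} {A : Set a} where

  ∑-cong : (xs : List A) {h k : A → ℤ} → (∀ x → h x ≡ k x) → ∑ xs h ≡ ∑ xs k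
  ∑-cong []       e = refl
  ∑-cong (x ∷ xs) e = cong₂ _+_ (e x) (∑-cong xs e)

  ∏-cong : (xs : List A) {h k : A → ℤ} → (∀ x → h x ≡ k x) → ∏ xs h ≡ ∏ xs k
  ∏-cong []       e = refl
  ∏-cong (x ∷ xs) e = cong₂ _*_ (e x) (∏-cong xs e)

  ∑-cong-All : ∀ {p} {P : A → Set p} {xs : List A} {h k : A → ℤ} →
               All P xs → (∀ {x} → P x → h x ≡ k x) → ∑ xs h ≡ ∑ xs k
  ∑-cong-All []         e = refl
  ∑-cong-All (px ∷ pxs) e = cong₂ _+_ (e px) (∑-cong-All pxs e)

  ∑-++ : (xs ys : List A) (h : A → ℤ) → ∑ (xs ++ ys) h ≡ ∑ xs h + ∑ ys h
  ∑-++ []       ys h = sym (ℤP.+-identityˡ _)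
  ∑-++ (x ∷ xs) ys h = trans (cong (_+_ (h x)) (∑-++ xs ys h)) (sym (ℤP.+-assoc (h x) _ _))

  ∏-++ : (xs ys : List A) (h : A → ℤ) → ∏ (xs ++ ys) h ≡ ∏ xs h * ∏ ys h
  ∏-++ []       ys h = sym (ℤP.*-identityˡ _)
  ∏-++ (x ∷ xs) ys h = trans (cong (h x *_) (∏-++ xs ys h)) (sym (ℤP.*-assoc (h x) _ _))

  ∑-zero : (xs : List A) → ∑ xs (λ _ → + 0) ≡ + 0
  ∑-zero []       = refl
  ∑-zero (x ∷ xs) = trans (ℤP.+-identityˡ _) (∑-zero xs)

  ∏-one : (xs : List A) → ∏ xs (λ _ → + 1) ≡ + 1
  ∏-one []       = refl
  ∏-one (x ∷ xs) = trans (ℤP.*-identityˡ _) (∏-one xs)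

  ∑-distrib-+ : (xs : List A) (h k : A → ℤ) → ∑ xs (λ x → h x + k x) ≡ ∑ xs h + ∑ xs k
  ∑-distrib-+ []       h k = refl
  ∑-distrib-+ (x ∷ xs) h k = trans (cong (_+_ (h x + k x)) (∑-distrib-+ xs h k))
    (solve 4 (λ a b c d → (a :+ b) :+ (c :+ d) := (a :+ c) :+ (b :+ d)) refl (h x) (k x) (∑ xs h) (∑ xs k))

  ∏-distrib-* : (xs : List A) (h k : A → ℤ) → ∏ xs (λ x → h x * k x) ≡ ∏ xs h * ∏ xs k
  ∏-distrib-* []       h k = refl
  ∏-distrib-* (x ∷ xs) h k = trans (cong (h x * k x *_) (∏-distrib-* xs h k))
    (solve 4 (λ a b c d → (a :* b) :* (c :* d) := (a :* c) :* (b :* d)) refl (h x) (k x) (∏ xs h) (∏ xs k))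

  ∑-neg : (xs : List A) (h : A → ℤ) → ∑ xs (λ x → - h x) ≡ - ∑ xs h
  ∑-neg []       h = refl
  ∑-neg (x ∷ xs) h = trans (cong (_+_ (- h x)) (∑-neg xs h)) (sym (ℤP.neg-distrib-+ (h x) _))

  ∑-*ˡ : (xs : List A) (c : ℤ) (h : A → ℤ) → ∑ xs (λ x → c * h x) ≡ c * ∑ xs h
  ∑-*ˡ []       c h = sym (ℤP.*-zeroʳ c)
  ∑-*ˡ (x ∷ xs) c h = trans (cong (_+_ (c * h x)) (∑-*ˡ xs c h)) (sym (ℤP.*-distribˡ-+ c (h x) _))

  ∑-*ʳ : (xs : List A) (c : ℤ) (h : A → ℤ) → ∑ xs (λ x → h x * c) ≡ ∑ xs h * c
  ∑-*ʳ xs c h = trans (∑-cong xs (λ x → ℤP.*-comm (h x) c)) (trans (∑-*ˡ xs c h) (ℤP.*-comm c _))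

module _ {a b} {A : Set a} {B : Set b} where

  ∑-map : (f : A → B) (xs : List A) (h : B → ℤ) → ∑ (map f xs) h ≡ ∑ xs (λ x → h (f x))
  ∑-map f []       h = refl
  ∑-map f (x ∷ xs) h = cong (_+_ (h (f x))) (∑-map f xs h)

  ∏-map : (f : A → B) (xs : List A) (h : B → ℤ) → ∏ (map f xs) h ≡ ∏ xs (λ x → h (f x))
  ∏-map f []       h = refl
  ∏-map f (x ∷ xs) h = cong (h (f x) *_) (∏-map f xs h)

  ∑-concatMap : (f : A → List B) (xs : List A) (h : B → ℤ) →
                ∑ (concatMap f xs) h ≡ ∑ xs (λ x → ∑ (f x) h)
  ∑-concatMap f []       h = refl
  ∑-concatMap f (x ∷ xs) h = trans (∑-++ (f x) _ h) (cong (_+_ (∑ (f x) h)) (∑-concatMap f xs h))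

  ∑-comm : (xs : List A) (ys : List B) (h : A → B → ℤ) →
           ∑ xs (λ x → ∑ ys (h x)) ≡ ∑ ys (λ y → ∑ xs (λ x → h x y))
  ∑-comm []       ys h = sym (∑-zero ys)
  ∑-comm (x ∷ xs) ys h = trans (cong (_+_ (∑ ys (h x))) (∑-comm xs ys h)) (sym (∑-distrib-+ ys (h x) _))

∑-tabulate : ∀ {a} {A : Set a} n (f : Fin n → A) (h : A → ℤ) → ∑ (tabulate f) h ≡ ∑ᶠ n (λ i → h (f i))
∑-tabulate zero    f h = refl
∑-tabulate (suc n) f h = cong (_+_ (h (f Fin.zero))) (∑-tabulate n (λ i → f (Fin.suc i)) h)

∑-allFin : (n : ℕ) (h : Fin n → ℤ) → ∑ (allFin n) h ≡ ∑ᶠ n h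
∑-allFin n h = ∑-tabulate n (λ i → i) h

∑ᶠ-cong : (n : ℕ) {h k : Fin n → ℤ} → (∀ i → h i ≡ k i) → ∑ᶠ n h ≡ ∑ᶠ n k
∑ᶠ-cong zero    e = refl
∑ᶠ-cong (suc n) e = cong₂ _+_ (e Fin.zero) (∑ᶠ-cong n (λ i → e (Fin.suc i)))

∏ᶠ-cong : (n : ℕ) {h k : Fin n → ℤ} → (∀ i → h i ≡ k i) → ∏ᶠ n h ≡ ∏ᶠ n k
∏ᶠ-cong zero    e = refl
∏ᶠ-cong (suc n) e = cong₂ _*_ (e Fin.zero) (∏ᶠ-cong n (λ i → e (Fin.suc i)))

∑ᶠ-zero : (n : ℕ) → ∑ᶠ n (λ _ → + 0) ≡ + 0
∑ᶠ-zero n = trans (sym (∑-allFin n _)) (∑-zero (allFin n))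

∏ᶠ-one : (n : ℕ) → ∏ᶠ n (λ _ → + 1) ≡ + 1
∏ᶠ-one zero    = refl
∏ᶠ-one (suc n) = trans (ℤP.*-identityˡ _) (∏ᶠ-one n)

∑ᶠ-distrib-+ : (n : ℕ) (h k : Fin n → ℤ) → ∑ᶠ n (λ i → h i + k i) ≡ ∑ᶠ n h + ∑ᶠ n k
∑ᶠ-distrib-+ n h k = trans (sym (∑-allFin n _))
  (trans (∑-distrib-+ (allFin n) h k) (cong₂ _+_ (∑-allFin n h) (∑-allFin n k)))

∏ᶠ-distrib-* : (n : ℕ) (h k : Fin n → ℤ) → ∏ᶠ n (λ i → h i * k i) ≡ ∏ᶠ n h * ∏ᶠ n k
∏ᶠ-distrib-* zero    h k = refl
∏ᶠ-distrib-* (suc n) h k = trans (cong (h Fin.zero * k Fin.zero *_) (∏ᶠ-distrib-* n _ _))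
  (solve 4 (λ a b c d → (a :* b) :* (c :* d) := (a :* c) :* (b :* d)) refl
     (h Fin.zero) (k Fin.zero) (∏ᶠ n (λ i → h (Fin.suc i))) (∏ᶠ n (λ i → k (Fin.suc i))))

∑ᶠ-neg : (n : ℕ) (h : Fin n → ℤ) → ∑ᶠ n (λ i → - h i) ≡ - ∑ᶠ n h
∑ᶠ-neg n h = trans (sym (∑-allFin n _)) (trans (∑-neg (allFin n) h) (cong -_ (∑-allFin n h)))

∑ᶠ-*ˡ : (n : ℕ) (c : ℤ) (h : Fin n → ℤ) → ∑ᶠ n (λ i → c * h i) ≡ c * ∑ᶠ n h
∑ᶠ-*ˡ n c h = trans (sym (∑-allFin n _)) (trans (∑-*ˡ (allFin n) c h) (cong (c *_) (∑-allFin n h)))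

∑-∑ᶠ-comm : ∀ {a} {A : Set a} (xs : List A) (n : ℕ) (h : A → Fin n → ℤ) →
            ∑ xs (λ x → ∑ᶠ n (h x)) ≡ ∑ᶠ n (λ i → ∑ xs (λ x → h x i))
∑-∑ᶠ-comm xs n h = trans (∑-cong xs (λ x → sym (∑-allFin n (h x))))
  (trans (∑-comm xs (allFin n) h) (∑-allFin n _))

∑ᶠ-comm : (n m : ℕ) (h : Fin n → Fin m → ℤ) →
          ∑ᶠ n (λ i → ∑ᶠ m (h i)) ≡ ∑ᶠ m (λ j → ∑ᶠ n (λ i → h i j))
∑ᶠ-comm n m h = trans (sym (∑-allFin n _)) (trans (∑-∑ᶠ-comm (allFin n) m h) (∑ᶠ-cong m (λ j → ∑-allFin n _)))

∏ᶠ-comm : (n m : ℕ) (h : Fin n → Fin m → ℤ) →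
          ∏ᶠ n (λ i → ∏ᶠ m (h i)) ≡ ∏ᶠ m (λ j → ∏ᶠ n (λ i → h i j))
∏ᶠ-comm zero    m h = sym (∏ᶠ-one m)
∏ᶠ-comm (suc n) m h = trans (cong (∏ᶠ m (h Fin.zero) *_) (∏ᶠ-comm n m (λ i → h (Fin.suc i))))
  (sym (∏ᶠ-distrib-* m _ _))

∑-allVecs-suc : ∀ {a} {A : Set a} (xs : List A) (n : ℕ) (h : Vec A (suc n) → ℤ) →
                ∑ (allVecs xs (suc n)) h ≡ ∑ xs (λ x → ∑ (allVecs xs n) (λ v → h (x ∷ v)))
∑-allVecs-suc xs n h = trans (∑-concatMap (λ x → map (x ∷_) (allVecs xs n)) xs h)
  (∑-cong xs (λ x → ∑-map (x ∷_) (allVecs xs n) h))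

∑-allVecs-∏ᶠ : ∀ {a} {A : Set a} (xs : List A) (n : ℕ) (h : Fin n → A → ℤ) →
               ∑ (allVecs xs n) (λ v → ∏ᶠ n (λ j → h j (lookup v j))) ≡ ∏ᶠ n (λ j → ∑ xs (h j))
∑-allVecs-∏ᶠ xs zero    h = refl
∑-allVecs-∏ᶠ xs (suc n) h = begin
    ∑ (allVecs xs (suc n)) (λ v → ∏ᶠ (suc n) (λ j → h j (lookup v j)))
  ≡⟨ ∑-allVecs-suc xs n (λ v → ∏ᶠ (suc n) (λ j → h j (lookup v j))) ⟩
    ∑ xs (λ x → ∑ (allVecs xs n) (λ v → h Fin.zero x * ∏ᶠ n (λ j → h (Fin.suc j) (lookup v j))))
  ≡⟨ ∑-cong xs (λ x → ∑-*ˡ (allVecs xs n) (h Fin.zero x) _) ⟩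
    ∑ xs (λ x → h Fin.zero x * ∑ (allVecs xs n) (λ v → ∏ᶠ n (λ j → h (Fin.suc j) (lookup v j))))
  ≡⟨ ∑-cong xs (λ x → cong (h Fin.zero x *_) (∑-allVecs-∏ᶠ xs n (λ j → h (Fin.suc j)))) ⟩
    ∑ xs (λ x → h Fin.zero x * ∏ᶠ n (λ j → ∑ xs (h (Fin.suc j))))
  ≡⟨ ∑-*ʳ xs _ (h Fin.zero) ⟩
    ∏ᶠ (suc n) (λ j → ∑ xs (h j))
  ∎
  where open ≡-Reasoning

∑-allVecs-columns : ∀ {a} {A : Set a} (xs : List A) (n m : ℕ) (H : Fin n → Vec A m → ℤ) →
  ∑ (allVecs (allVecs xs n) m) (λ rows → ∏ᶠ n (λ j → H j (Vec.map (λ r → lookup r j) rows)))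
  ≡ ∏ᶠ n (λ j → ∑ (allVecs xs m) (H j))
∑-allVecs-columns xs n zero    H = trans (ℤP.+-identityʳ _) (∏ᶠ-cong n (λ j → sym (ℤP.+-identityʳ _)))
∑-allVecs-columns xs n (suc m) H = begin
    ∑ (allVecs (allVecs xs n) (suc m)) (λ rows → ∏ᶠ n (λ j → H j (Vec.map (λ r → lookup r j) rows)))
  ≡⟨ ∑-allVecs-suc (allVecs xs n) m (λ rows → ∏ᶠ n (λ j → H j (Vec.map (λ r → lookup r j) rows))) ⟩
    ∑ (allVecs xs n) (λ r → ∑ (allVecs (allVecs xs n) m)
                        (λ rows → ∏ᶠ n (λ j → H j (lookup r j ∷ Vec.map (λ r → lookup r j) rows))))
  ≡⟨ ∑-cong (allVecs xs n) (λ r → ∑-allVecs-columns xs n m (λ j c → H j (lookup r j ∷ c))) ⟩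
    ∑ (allVecs xs n) (λ r → ∏ᶠ n (λ j → ∑ (allVecs xs m) (λ c → H j (lookup r j ∷ c))))
  ≡⟨ ∑-allVecs-∏ᶠ xs n (λ j x → ∑ (allVecs xs m) (λ c → H j (x ∷ c))) ⟩
    ∏ᶠ n (λ j → ∑ xs (λ x → ∑ (allVecs xs m) (λ c → H j (x ∷ c))))
  ≡⟨ ∏ᶠ-cong n (λ j → sym (∑-allVecs-suc xs m (H j))) ⟩
    ∏ᶠ n (λ j → ∑ (allVecs xs (suc m)) (H j))
  ∎
  where open ≡-Reasoning

𝟙 : Bool → ℕ
𝟙 true  = 1
𝟙 false = 0

⟦_⟧ : Bool → ℤ
⟦ b ⟧ = + 𝟙 b

⟦∧⟧ : ∀ a b → ⟦ a ∧ b ⟧ ≡ ⟦ a ⟧ * ⟦ b ⟧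
⟦∧⟧ true  b = sym (ℤP.*-identityˡ _)
⟦∧⟧ false b = refl

⟦⟧≡1-⟦not⟧ : ∀ b → ⟦ b ⟧ ≡ + 1 - ⟦ not b ⟧
⟦⟧≡1-⟦not⟧ true  = refl
⟦⟧≡1-⟦not⟧ false = refl

⟦not∨⟧ : ∀ a b → ⟦ not (a ∨ b) ⟧ ≡ ⟦ not a ⟧ * ⟦ not b ⟧
⟦not∨⟧ true  b = refl
⟦not∨⟧ false b = sym (ℤP.*-identityˡ _)

if-then-0 : ∀ b (u : ℤ) → (if b then u else + 0) ≡ ⟦ b ⟧ * u
if-then-0 true  u = sym (ℤP.*-identityˡ u)
if-then-0 false u = refl

-- Encodes that xs lists every element of A exactly once.
Enumerates : ∀ {a} {A : Set a} → DecidableEquality A → List A → Set a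
Enumerates {A = A} _≟_ xs = ∀ (h : A → ℤ) z → ∑ xs (λ y → ⟦ does (y ≟ z) ⟧ * h y) ≡ h z

∑ᶠ-pick : ∀ n (h : Fin n → ℤ) z → ∑ᶠ n (λ y → ⟦ does (y ≟F z) ⟧ * h y) ≡ h z
∑ᶠ-pick (suc n) h Fin.zero = begin
    + 1 * h Fin.zero + ∑ᶠ n (λ y → + 0 * h (Fin.suc y))
  ≡⟨ cong₂ _+_ (ℤP.*-identityˡ (h Fin.zero))
               (trans (∑ᶠ-cong n {k = λ _ → + 0} (λ y → ℤP.*-zeroˡ (h (Fin.suc y)))) (∑ᶠ-zero n)) ⟩
    h Fin.zero + + 0
  ≡⟨ ℤP.+-identityʳ _ ⟩
    h Fin.zero
  ∎
  where open ≡-Reasoning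
∑ᶠ-pick (suc n) h (Fin.suc z) = trans (ℤP.+-identityˡ _) (∑ᶠ-pick n (λ y → h (Fin.suc y)) z)

allFin-enumerates : ∀ n → Enumerates _≟F_ (allFin n)
allFin-enumerates n h z = trans (∑-allFin n _) (∑ᶠ-pick n h z)

bools-enumerates : Enumerates _≟B_ (true ∷ false ∷ [])
bools-enumerates h true  = solve 2 (λ a b → con (+ 1) :* a :+ (con (+ 0) :* b :+ con (+ 0)) := a) refl (h true) (h false)
bools-enumerates h false = solve 2 (λ a b → con (+ 0) :* a :+ (con (+ 1) :* b :+ con (+ 0)) := b) refl (h true) (h false)

allVecs-enumerates : ∀ {a} {A : Set a} {_≟_ : DecidableEquality A} {xs : List A} →
                     Enumerates _≟_ xs → ∀ n → Enumerates (≡-dec _≟_) (allVecs xs n)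
allVecs-enumerates enum zero    h []       = trans (ℤP.+-identityʳ _) (ℤP.*-identityˡ _)
allVecs-enumerates {_≟_ = _≟_} {xs} enum (suc n) h (w₀ ∷ w) = begin
    ∑ (allVecs xs (suc n)) (λ v → ⟦ does (≡-dec _≟_ v (w₀ ∷ w)) ⟧ * h v)
  ≡⟨ ∑-allVecs-suc xs n (λ v → ⟦ does (≡-dec _≟_ v (w₀ ∷ w)) ⟧ * h v) ⟩
    ∑ xs (λ x → ∑ (allVecs xs n) (λ v → ⟦ does (x ≟ w₀) ∧ does (≡-dec _≟_ v w) ⟧ * h (x ∷ v)))
  ≡⟨ ∑-cong xs (λ x → ∑-cong (allVecs xs n) (λ v →
       trans (cong (_* h (x ∷ v)) (⟦∧⟧ (does (x ≟ w₀)) _)) (ℤP.*-assoc ⟦ does (x ≟ w₀) ⟧ _ _))) ⟩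
    ∑ xs (λ x → ∑ (allVecs xs n) (λ v → ⟦ does (x ≟ w₀) ⟧ * (⟦ does (≡-dec _≟_ v w) ⟧ * h (x ∷ v))))
  ≡⟨ ∑-cong xs (λ x → trans (∑-*ˡ (allVecs xs n) ⟦ does (x ≟ w₀) ⟧ _)
                        (cong (⟦ does (x ≟ w₀) ⟧ *_) (allVecs-enumerates enum n (λ v → h (x ∷ v)) w))) ⟩
    ∑ xs (λ x → ⟦ does (x ≟ w₀) ⟧ * h (x ∷ w))
  ≡⟨ enum (λ x → h (x ∷ w)) w₀ ⟩
    h (w₀ ∷ w)
  ∎
  where open ≡-Reasoning

_≟ᶜ_ : ∀ {m} → DecidableEquality (Vec Bool m)
_≟ᶜ_ = ≡-dec _≟B_

cube-enumerates : ∀ m → Enumerates _≟ᶜ_ (cube m)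
cube-enumerates = allVecs-enumerates bools-enumerates

∑-cube-suc : ∀ m (h : Vec Bool (suc m) → ℤ) →
             ∑ (cube (suc m)) h ≡ ∑ (cube m) (λ ε → h (true ∷ ε)) + ∑ (cube m) (λ ε → h (false ∷ ε))
∑-cube-suc m h = trans (∑-allVecs-suc (true ∷ false ∷ []) m h)
                       (cong (_+_ (∑ (cube m) (λ ε → h (true ∷ ε)))) (ℤP.+-identityʳ _))

∏-cube-suc : ∀ m (h : Vec Bool (suc m) → ℤ) →
             ∏ (cube (suc m)) h ≡ ∏ (cube m) (λ ε → h (true ∷ ε)) * ∏ (cube m) (λ ε → h (false ∷ ε))
∏-cube-suc m h = begin
    ∏ (map (true ∷_) (cube m) ++ (map (false ∷_) (cube m) ++ [])) h
  ≡⟨ ∏-++ (map (true ∷_) (cube m)) _ h ⟩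
    ∏ (map (true ∷_) (cube m)) h * ∏ (map (false ∷_) (cube m) ++ []) h
  ≡⟨ cong₂ _*_ (∏-map (true ∷_) (cube m) h)
       (trans (∏-++ (map (false ∷_) (cube m)) [] h) (trans (ℤP.*-identityʳ _) (∏-map (false ∷_) (cube m) h))) ⟩
    ∏ (cube m) (λ ε → h (true ∷ ε)) * ∏ (cube m) (λ ε → h (false ∷ ε))
  ∎
  where open ≡-Reasoning

∏-cube-pick : ∀ m (h : Vec Bool m → ℤ) w → ∏ (cube m) (λ δ → h δ ^ 𝟙 (does (δ ≟ᶜ w))) ≡ h w
∏-cube-pick zero    h []      = trans (ℤP.*-identityʳ _) (ℤP.*-identityʳ _)
∏-cube-pick (suc m) h (b ∷ w) = trans (∏-cube-suc m (λ δ → h δ ^ 𝟙 (does (δ ≟ᶜ (b ∷ w))))) (split b)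
  where
  split : ∀ b → ∏ (cube m) (λ δ → h (true ∷ δ) ^ 𝟙 (does (true ≟B b) ∧ does (δ ≟ᶜ w)))
              * ∏ (cube m) (λ δ → h (false ∷ δ) ^ 𝟙 (does (false ≟B b) ∧ does (δ ≟ᶜ w))) ≡ h (b ∷ w)
  split true  = trans (cong₂ _*_ (∏-cube-pick m (λ δ → h (true ∷ δ)) w) (∏-one (cube m))) (ℤP.*-identityʳ _)
  split false = trans (cong₂ _*_ (∏-one (cube m)) (∏-cube-pick m (λ δ → h (false ∷ δ)) w)) (ℤP.*-identityˡ _)

∏ᶠ-one-minus : ∀ m (b : Fin m → ℤ) →
  ∏ᶠ m (λ i → + 1 - b i) ≡ ∑ (cube m) (λ ε → -1ℤ ^ ones ε * ∏ᶠ m (λ i → if lookup ε i then b i else + 1))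
∏ᶠ-one-minus zero    b = refl
∏ᶠ-one-minus (suc m) b = sym (begin
    ∑ (cube (suc m)) (λ ε → -1ℤ ^ ones ε * ∏ᶠ (suc m) (λ i → if lookup ε i then b i else + 1))
  ≡⟨ ∑-cube-suc m (λ ε → -1ℤ ^ ones ε * ∏ᶠ (suc m) (λ i → if lookup ε i then b i else + 1)) ⟩
    ∑ (cube m) (λ ε → -1ℤ ^ suc (ones ε) * (b Fin.zero * P ε)) + ∑ (cube m) (λ ε → -1ℤ ^ ones ε * (+ 1 * P ε))
  ≡⟨ cong₂ _+_ (∑-cong (cube m) (λ ε → solve 3 (λ s b₀ p → (con -1ℤ :* s) :* (b₀ :* p) := (:- b₀) :* (s :* p))
                                           refl (-1ℤ ^ ones ε) (b Fin.zero) (P ε)))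
               (∑-cong (cube m) (λ ε → cong (-1ℤ ^ ones ε *_) (ℤP.*-identityˡ (P ε)))) ⟩
    ∑ (cube m) (λ ε → - b Fin.zero * (-1ℤ ^ ones ε * P ε)) + S
  ≡⟨ cong (_+ S) (∑-*ˡ (cube m) (- b Fin.zero) (λ ε → -1ℤ ^ ones ε * P ε)) ⟩
    - b Fin.zero * S + S
  ≡⟨ solve 2 (λ b₀ s → (:- b₀) :* s :+ s := (con (+ 1) :- b₀) :* s) refl (b Fin.zero) S ⟩
    (+ 1 - b Fin.zero) * S
  ≡⟨ cong ((+ 1 - b Fin.zero) *_) (sym (∏ᶠ-one-minus m (λ i → b (Fin.suc i)))) ⟩
    ∏ᶠ (suc m) (λ i → + 1 - b i)
  ∎)
  where
  open ≡-Reasoning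
  P : Vec Bool m → ℤ
  P ε = ∏ᶠ m (λ i → if lookup ε i then b (Fin.suc i) else + 1)
  S : ℤ
  S = ∑ (cube m) (λ ε → -1ℤ ^ ones ε * P ε)

-- Set partitions and the partition sum defining g

μ : ∀ {m} → Vec Bool m → ℤ
μ B = (-1ℤ ^ (ones B ∸ 1)) * + ((ones B ∸ 1) !)

partitionSum : (m : ℕ) → (Vec Bool m → ℤ) → ℤ
partitionSum m N = ∑ (partitions m) (λ π → ∏ π μ * ∏ π N)

partitionSum-cong : ∀ m {N N′ : Vec Bool m → ℤ} → (∀ B → N B ≡ N′ B) → partitionSum m N ≡ partitionSum m N′
partitionSum-cong m e = ∑-cong (partitions m) (λ π → cong (∏ π μ *_) (∏-cong π e))

blocksContaining : ∀ {m} → Fin m → List (Vec Bool m) → ℕ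
blocksContaining i []      = 0
blocksContaining i (B ∷ π) = 𝟙 (lookup B i) ℕ.+ blocksContaining i π

NonEmpty : ∀ {m} → Vec Bool m → Set
NonEmpty B = 1 ≤ ones B

IsPartition : ∀ {m} → List (Vec Bool m) → Set
IsPartition {m} π = (∀ (i : Fin m) → blocksContaining i π ≡ 1) × All NonEmpty π

blocksContaining-suc : ∀ {m} b (i : Fin m) π → blocksContaining (Fin.suc i) (map (b ∷_) π) ≡ blocksContaining i π
blocksContaining-suc b i []      = refl
blocksContaining-suc b i (B ∷ π) = cong (𝟙 (lookup B i) ℕ.+_) (blocksContaining-suc b i π)

blocksContaining-zero : ∀ {m} π → blocksContaining {suc m} Fin.zero (map (false ∷_) π) ≡ 0
blocksContaining-zero []      = refl
blocksContaining-zero (B ∷ π) = blocksContaining-zero π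

nonEmpty-false∷ : ∀ {m} {π : List (Vec Bool m)} → All NonEmpty π → All NonEmpty (map (false ∷_) π)
nonEmpty-false∷ []       = []
nonEmpty-false∷ (p ∷ ps) = p ∷ nonEmpty-false∷ ps

addToOne-isPartition : ∀ {m} (π : List (Vec Bool m)) → All NonEmpty π →
  All (λ π′ → (∀ i → blocksContaining (Fin.suc i) π′ ≡ blocksContaining i π)
              × blocksContaining Fin.zero π′ ≡ 1 × All NonEmpty π′) (addToOne π)
addToOne-isPartition []       _        = []
addToOne-isPartition (B ∷ Bs) (p ∷ ps) =
  ((λ i → cong (𝟙 (lookup B i) ℕ.+_) (blocksContaining-suc false i Bs)) ,
   cong suc (blocksContaining-zero Bs) , ℕ.s≤s ℕ.z≤n ∷ nonEmpty-false∷ ps)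
  ∷ map⁺ (All.map (λ { (c , c₀ , ne) → (λ i → cong (𝟙 (lookup B i) ℕ.+_) (c i)) , c₀ , p ∷ ne })
                  (addToOne-isPartition Bs ps))

singleton∷ : ∀ {m} → List (Vec Bool m) → List (Vec Bool (suc m))
singleton∷ {m} π = (true ∷ Vec.replicate m false) ∷ map (false ∷_) π

partitions-isPartition : ∀ m → All IsPartition (partitions m)
partitions-isPartition zero    = ((λ ()) , []) ∷ []
partitions-isPartition (suc m) = concat⁺ (map⁺ (All.map extend (partitions-isPartition m)))
  where
  extend : ∀ {π} → IsPartition π → All IsPartition (singleton∷ π ∷ addToOne π)
  extend {π} (c , ne) =
    ((λ { Fin.zero    → cong suc (blocksContaining-zero π)
        ; (Fin.suc i) → trans (cong (λ b → 𝟙 b ℕ.+ blocksContaining (Fin.suc i) (map (false ∷_) π))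
                                    (lookup-replicate i false))
                              (trans (blocksContaining-suc false i π) (c i)) }) ,
     ℕ.s≤s ℕ.z≤n ∷ nonEmpty-false∷ ne)
    ∷ All.map (λ { (c′ , c₀ , ne′) → (λ { Fin.zero → c₀ ; (Fin.suc i) → trans (c′ i) (c i) }) , ne′ })
              (addToOne-isPartition π ne)

-- replaceOne π X Y = ∑_{B ∈ π} X B * ∏_{B′ ∈ π, B′ ≠ B} Y B′
replaceOne : ∀ {m} → List (Vec Bool m) → (Vec Bool m → ℤ) → (Vec Bool m → ℤ) → ℤ
replaceOne []      X Y = + 0
replaceOne (B ∷ π) X Y = X B * ∏ π Y + Y B * replaceOne π X Y

replaceOne-cong : ∀ {m} {π : List (Vec Bool m)} {X X′ Y : Vec Bool m → ℤ} → All NonEmpty π →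
                  (∀ {B} → NonEmpty B → X B ≡ X′ B) → replaceOne π X Y ≡ replaceOne π X′ Y
replaceOne-cong                 []       e = refl
replaceOne-cong {π = B ∷ π} {Y = Y} (p ∷ ps) e =
  cong₂ (λ x r → x * ∏ π Y + Y B * r) (e p) (replaceOne-cong ps e)

replaceOne-scale : ∀ {m} (π : List (Vec Bool m)) (c X Y : Vec Bool m → ℤ) →
  replaceOne π (λ B → c B * X B) (λ B → c B * Y B) ≡ ∏ π c * replaceOne π X Y
replaceOne-scale []      c X Y = refl
replaceOne-scale (B ∷ π) c X Y = begin
    c B * X B * ∏ π (λ B → c B * Y B) + c B * Y B * replaceOne π (λ B → c B * X B) (λ B → c B * Y B)
  ≡⟨ cong₂ (λ p r → c B * X B * p + c B * Y B * r) (∏-distrib-* π c Y) (replaceOne-scale π c X Y) ⟩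
    c B * X B * (∏ π c * ∏ π Y) + c B * Y B * (∏ π c * replaceOne π X Y)
  ≡⟨ solve 6 (λ cB XB YB Pc PY S → cB :* XB :* (Pc :* PY) :+ cB :* YB :* (Pc :* S)
                                := cB :* Pc :* (XB :* PY :+ YB :* S))
       refl (c B) (X B) (Y B) (∏ π c) (∏ π Y) (replaceOne π X Y) ⟩
    c B * ∏ π c * (X B * ∏ π Y + Y B * replaceOne π X Y)
  ∎
  where open ≡-Reasoning

replaceOne-neg : ∀ {m} (π : List (Vec Bool m)) (X Y : Vec Bool m → ℤ) →
                 replaceOne π (λ B → - X B) Y ≡ - replaceOne π X Y
replaceOne-neg []      X Y = refl
replaceOne-neg (B ∷ π) X Y = trans (cong (λ r → - X B * ∏ π Y + Y B * r) (replaceOne-neg π X Y))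
  (solve 4 (λ x p y r → (:- x) :* p :+ y :* (:- r) := :- (x :* p :+ y :* r)) refl (X B) (∏ π Y) (Y B) (replaceOne π X Y))

replaceOne-∑ᶠ : ∀ {m} k (π : List (Vec Bool m)) (X : Fin k → Vec Bool m → ℤ) (Y : Vec Bool m → ℤ) →
                replaceOne π (λ B → ∑ᶠ k (λ i → X i B)) Y ≡ ∑ᶠ k (λ i → replaceOne π (X i) Y)
replaceOne-∑ᶠ k []      X Y = sym (∑ᶠ-zero k)
replaceOne-∑ᶠ k (B ∷ π) X Y = begin
    ∑ᶠ k (λ i → X i B) * ∏ π Y + Y B * replaceOne π (λ B → ∑ᶠ k (λ i → X i B)) Y
  ≡⟨ cong₂ _+_ (trans (ℤP.*-comm (∑ᶠ k (λ i → X i B)) _) (sym (∑ᶠ-*ˡ k (∏ π Y) (λ i → X i B))))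
               (trans (cong (Y B *_) (replaceOne-∑ᶠ k π X Y)) (sym (∑ᶠ-*ˡ k (Y B) _))) ⟩
    ∑ᶠ k (λ i → ∏ π Y * X i B) + ∑ᶠ k (λ i → Y B * replaceOne π (X i) Y)
  ≡⟨ sym (∑ᶠ-distrib-+ k _ _) ⟩
    ∑ᶠ k (λ i → ∏ π Y * X i B + Y B * replaceOne π (X i) Y)
  ≡⟨ ∑ᶠ-cong k (λ i → cong (_+ Y B * replaceOne π (X i) Y) (ℤP.*-comm (∏ π Y) (X i B))) ⟩
    ∑ᶠ k (λ i → replaceOne (B ∷ π) (X i) Y)
  ∎
  where open ≡-Reasoning

module _ {m} (i : Fin m) (X Y : Vec Bool m → ℤ) where

  replaceOne-absent : ∀ π → blocksContaining i π ≡ 0 → replaceOne π (λ B → ⟦ lookup B i ⟧ * X B) Y ≡ + 0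
  replaceOne-absent []      e = refl
  replaceOne-absent (B ∷ π) e with lookup B i
  ... | false = trans (ℤP.+-identityˡ _) (trans (cong (Y B *_) (replaceOne-absent π e)) (ℤP.*-zeroʳ (Y B)))

  ∏-absent : ∀ π → blocksContaining i π ≡ 0 → ∏ π (λ B → if lookup B i then X B else Y B) ≡ ∏ π Y
  ∏-absent []      e = refl
  ∏-absent (B ∷ π) e with lookup B i
  ... | false = cong (Y B *_) (∏-absent π e)

  replaceOne-unique : ∀ π → blocksContaining i π ≡ 1 →
    replaceOne π (λ B → ⟦ lookup B i ⟧ * X B) Y ≡ ∏ π (λ B → if lookup B i then X B else Y B)
  replaceOne-unique (B ∷ π) e with lookup B i
  ... | true  = begin
      + 1 * X B * ∏ π Y + Y B * replaceOne π (λ B → ⟦ lookup B i ⟧ * X B) Y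
    ≡⟨ cong₂ (λ x r → x * ∏ π Y + Y B * r) (ℤP.*-identityˡ (X B)) (replaceOne-absent π (ℕP.suc-injective e)) ⟩
      X B * ∏ π Y + Y B * + 0
    ≡⟨ trans (cong (_+_ (X B * ∏ π Y)) (ℤP.*-zeroʳ (Y B))) (ℤP.+-identityʳ _) ⟩
      X B * ∏ π Y
    ≡⟨ cong (X B *_) (sym (∏-absent π (ℕP.suc-injective e))) ⟩
      X B * ∏ π (λ B → if lookup B i then X B else Y B)
    ∎
    where open ≡-Reasoning
  ... | false = trans (ℤP.+-identityˡ _) (cong (Y B *_) (replaceOne-unique π e))

ones-∑ᶠ : ∀ {m} (B : Vec Bool m) → + ones B ≡ ∑ᶠ m (λ i → ⟦ lookup B i ⟧)
ones-∑ᶠ []          = refl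
ones-∑ᶠ (true ∷ B)  = trans (ℤP.pos-+ 1 (ones B)) (cong (_+_ (+ 1)) (ones-∑ᶠ B))
ones-∑ᶠ (false ∷ B) = trans (ones-∑ᶠ B) (sym (ℤP.+-identityˡ _))

-- Weighting each block by its size counts the pairs (i, block containing i).
replaceOne-size : ∀ {m} (π : List (Vec Bool m)) (X Y : Vec Bool m → ℤ) → IsPartition π →
  replaceOne π (λ B → + ones B * X B) Y ≡ ∑ᶠ m (λ i → ∏ π (λ B → if lookup B i then X B else Y B))
replaceOne-size {m} π X Y (c , ne) = begin
    replaceOne π (λ B → + ones B * X B) Y
  ≡⟨ replaceOne-cong ne (λ {B} _ → trans (cong (_* X B) (ones-∑ᶠ B))
                                   (trans (ℤP.*-comm (∑ᶠ m (λ i → ⟦ lookup B i ⟧)) _)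
                                   (trans (sym (∑ᶠ-*ˡ m (X B) _)) (∑ᶠ-cong m (λ i → ℤP.*-comm (X B) _))))) ⟩
    replaceOne π (λ B → ∑ᶠ m (λ i → ⟦ lookup B i ⟧ * X B)) Y
  ≡⟨ replaceOne-∑ᶠ m π (λ i B → ⟦ lookup B i ⟧ * X B) Y ⟩
    ∑ᶠ m (λ i → replaceOne π (λ B → ⟦ lookup B i ⟧ * X B) Y)
  ≡⟨ ∑ᶠ-cong m (λ i → replaceOne-unique i X Y π (c i)) ⟩
    ∑ᶠ m (λ i → ∏ π (λ B → if lookup B i then X B else Y B))
  ∎
  where open ≡-Reasoning

e₀ : ∀ {m} → Vec Bool (suc m)
e₀ {m} = true ∷ Vec.replicate m false

ones-replicate-false : ∀ m → ones (Vec.replicate m false) ≡ 0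
ones-replicate-false zero    = refl
ones-replicate-false (suc m) = ones-replicate-false m

μ-e₀ : ∀ {m} → μ (e₀ {m}) ≡ + 1
μ-e₀ {m} = cong (λ k → -1ℤ ^ k * + (k !)) (ones-replicate-false m)

μ-true∷ : ∀ {m} (B : Vec Bool m) → NonEmpty B → μ (true ∷ B) ≡ μ B * - + ones B
μ-true∷ B ne with ones B
... | suc k = trans (cong (-1ℤ ^ suc k *_) (ℤP.pos-* (suc k) (k !)))
  (solve 3 (λ s n f → (con -1ℤ :* s) :* (n :* f) := (s :* f) :* (:- n)) refl (-1ℤ ^ k) (+ suc k) (+ (k !)))

∑-addToOne : ∀ {m} (π : List (Vec Bool m)) (N : Vec Bool (suc m) → ℤ) →
  ∑ (addToOne π) (λ π′ → ∏ π′ μ * ∏ π′ N)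
  ≡ replaceOne π (λ B → μ (true ∷ B) * N (true ∷ B)) (λ B → μ B * N (false ∷ B))
∑-addToOne []       N = refl
∑-addToOne (B ∷ Bs) N = cong₂ _+_ first rest
  where
  open ≡-Reasoning
  swap-middle : ∀ a b c d → (a * b) * (c * d) ≡ (a * c) * (b * d)
  swap-middle = solve 4 (λ a b c d → (a :* b) :* (c :* d) := (a :* c) :* (b :* d)) refl
  first : μ (true ∷ B) * ∏ (map (false ∷_) Bs) μ * (N (true ∷ B) * ∏ (map (false ∷_) Bs) N)
          ≡ μ (true ∷ B) * N (true ∷ B) * ∏ Bs (λ B → μ B * N (false ∷ B))
  first = begin
      μ (true ∷ B) * ∏ (map (false ∷_) Bs) μ * (N (true ∷ B) * ∏ (map (false ∷_) Bs) N)
    ≡⟨ cong₂ (λ p q → μ (true ∷ B) * p * (N (true ∷ B) * q)) (∏-map (false ∷_) Bs μ) (∏-map (false ∷_) Bs N) ⟩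
      μ (true ∷ B) * ∏ Bs μ * (N (true ∷ B) * ∏ Bs (λ B → N (false ∷ B)))
    ≡⟨ swap-middle (μ (true ∷ B)) (∏ Bs μ) (N (true ∷ B)) (∏ Bs (λ B → N (false ∷ B))) ⟩
      μ (true ∷ B) * N (true ∷ B) * (∏ Bs μ * ∏ Bs (λ B → N (false ∷ B)))
    ≡⟨ cong (μ (true ∷ B) * N (true ∷ B) *_) (sym (∏-distrib-* Bs μ (λ B → N (false ∷ B)))) ⟩
      μ (true ∷ B) * N (true ∷ B) * ∏ Bs (λ B → μ B * N (false ∷ B))
    ∎
  rest : ∑ (map ((false ∷ B) ∷_) (addToOne Bs)) (λ π′ → ∏ π′ μ * ∏ π′ N)
         ≡ μ B * N (false ∷ B) * replaceOne Bs (λ B → μ (true ∷ B) * N (true ∷ B)) (λ B → μ B * N (false ∷ B))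
  rest = begin
      ∑ (map ((false ∷ B) ∷_) (addToOne Bs)) (λ π′ → ∏ π′ μ * ∏ π′ N)
    ≡⟨ ∑-map ((false ∷ B) ∷_) (addToOne Bs) (λ π′ → ∏ π′ μ * ∏ π′ N) ⟩
      ∑ (addToOne Bs) (λ π′ → μ B * ∏ π′ μ * (N (false ∷ B) * ∏ π′ N))
    ≡⟨ ∑-cong (addToOne Bs) (λ π′ → swap-middle (μ B) (∏ π′ μ) (N (false ∷ B)) (∏ π′ N)) ⟩
      ∑ (addToOne Bs) (λ π′ → μ B * N (false ∷ B) * (∏ π′ μ * ∏ π′ N))
    ≡⟨ ∑-*ˡ (addToOne Bs) (μ B * N (false ∷ B)) (λ π′ → ∏ π′ μ * ∏ π′ N) ⟩
      μ B * N (false ∷ B) * ∑ (addToOne Bs) (λ π′ → ∏ π′ μ * ∏ π′ N)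
    ≡⟨ cong (μ B * N (false ∷ B) *_) (∑-addToOne Bs N) ⟩
      μ B * N (false ∷ B) * replaceOne Bs (λ B → μ (true ∷ B) * N (true ∷ B)) (λ B → μ B * N (false ∷ B))
    ∎

-- Contribution of the partitions of {1,…,m+1} that restrict to π on {2,…,m+1}.
partitionSum-suc-term : ∀ {m} (N : Vec Bool (suc m) → ℤ) (π : List (Vec Bool m)) → IsPartition π →
  ∑ (singleton∷ π ∷ addToOne π) (λ π′ → ∏ π′ μ * ∏ π′ N)
  ≡ N e₀ * (∏ π μ * ∏ π (λ B → N (false ∷ B))) + - ∑ᶠ m (λ i → ∏ π μ * ∏ π (λ B → N (lookup B i ∷ B)))
partitionSum-suc-term {m} N π isP@(_ , ne) = cong₂ _+_ singleton-term (trans (∑-addToOne π N) added-terms)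
  where
  open ≡-Reasoning
  Y : Vec Bool m → ℤ
  Y B = N (false ∷ B)
  singleton-term : μ (e₀ {m}) * ∏ (map (false ∷_) π) μ * (N e₀ * ∏ (map (false ∷_) π) N)
                   ≡ N e₀ * (∏ π μ * ∏ π Y)
  singleton-term = begin
      μ (e₀ {m}) * ∏ (map (false ∷_) π) μ * (N e₀ * ∏ (map (false ∷_) π) N)
    ≡⟨ cong₂ (λ u (pq : ℤ × ℤ) → u * proj₁ pq * (N e₀ * proj₂ pq))
             (μ-e₀ {m}) (cong₂ _,_ (∏-map (false ∷_) π μ) (∏-map (false ∷_) π N)) ⟩
      + 1 * ∏ π μ * (N e₀ * ∏ π Y)
    ≡⟨ solve 3 (λ a b c → con (+ 1) :* a :* (b :* c) := b :* (a :* c)) refl (∏ π μ) (N e₀) (∏ π Y) ⟩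
      N e₀ * (∏ π μ * ∏ π Y)
    ∎
  if-∷ : ∀ b B → (if b then N (true ∷ B) else N (false ∷ B)) ≡ N (b ∷ B)
  if-∷ true  B = refl
  if-∷ false B = refl
  added-terms : replaceOne π (λ B → μ (true ∷ B) * N (true ∷ B)) (λ B → μ B * Y B)
                ≡ - ∑ᶠ m (λ i → ∏ π μ * ∏ π (λ B → N (lookup B i ∷ B)))
  added-terms = begin
      replaceOne π (λ B → μ (true ∷ B) * N (true ∷ B)) (λ B → μ B * Y B)
    ≡⟨ replaceOne-cong ne (λ {B} nb → trans (cong (_* N (true ∷ B)) (μ-true∷ B nb))
                                        (trans (ℤP.*-assoc (μ B) _ _)
                                          (cong (μ B *_) (sym (ℤP.neg-distribˡ-* (+ ones B) _))))) ⟩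
      replaceOne π (λ B → μ B * - (+ ones B * N (true ∷ B))) (λ B → μ B * Y B)
    ≡⟨ replaceOne-scale π μ (λ B → - (+ ones B * N (true ∷ B))) Y ⟩
      ∏ π μ * replaceOne π (λ B → - (+ ones B * N (true ∷ B))) Y
    ≡⟨ cong (∏ π μ *_) (replaceOne-neg π (λ B → + ones B * N (true ∷ B)) Y) ⟩
      ∏ π μ * - replaceOne π (λ B → + ones B * N (true ∷ B)) Y
    ≡⟨ cong (λ r → ∏ π μ * - r) (replaceOne-size π (λ B → N (true ∷ B)) Y isP) ⟩
      ∏ π μ * - ∑ᶠ m (λ i → ∏ π (λ B → if lookup B i then N (true ∷ B) else N (false ∷ B)))
    ≡⟨ cong (λ r → ∏ π μ * - r) (∑ᶠ-cong m (λ i → ∏-cong π (λ B → if-∷ (lookup B i) B))) ⟩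
      ∏ π μ * - ∑ᶠ m (λ i → ∏ π (λ B → N (lookup B i ∷ B)))
    ≡⟨ trans (sym (ℤP.neg-distribʳ-* (∏ π μ) _)) (cong -_ (sym (∑ᶠ-*ˡ m (∏ π μ) _))) ⟩
      - ∑ᶠ m (λ i → ∏ π μ * ∏ π (λ B → N (lookup B i ∷ B)))
    ∎

partitionSum-suc : ∀ m (N : Vec Bool (suc m) → ℤ) →
  partitionSum (suc m) N
  ≡ N e₀ * partitionSum m (λ B → N (false ∷ B)) - ∑ᶠ m (λ i → partitionSum m (λ B → N (lookup B i ∷ B)))
partitionSum-suc m N = begin
    partitionSum (suc m) N
  ≡⟨ ∑-concatMap (λ π → singleton∷ π ∷ addToOne π) (partitions m) (λ π′ → ∏ π′ μ * ∏ π′ N) ⟩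
    ∑ (partitions m) (λ π → ∑ (singleton∷ π ∷ addToOne π) (λ π′ → ∏ π′ μ * ∏ π′ N))
  ≡⟨ ∑-cong-All (partitions-isPartition m) (partitionSum-suc-term N _) ⟩
    ∑ (partitions m) (λ π → N e₀ * Z₀ π + - ∑ᶠ m (Z π))
  ≡⟨ ∑-distrib-+ (partitions m) (λ π → N e₀ * Z₀ π) (λ π → - ∑ᶠ m (Z π)) ⟩
    ∑ (partitions m) (λ π → N e₀ * Z₀ π) + ∑ (partitions m) (λ π → - ∑ᶠ m (Z π))
  ≡⟨ cong₂ _+_ (∑-*ˡ (partitions m) (N e₀) Z₀)
               (trans (∑-neg (partitions m) (λ π → ∑ᶠ m (Z π))) (cong -_ (∑-∑ᶠ-comm (partitions m) m Z))) ⟩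
    N e₀ * partitionSum m (λ B → N (false ∷ B)) - ∑ᶠ m (λ i → partitionSum m (λ B → N (lookup B i ∷ B)))
  ∎
  where
  open ≡-Reasoning
  Z₀ : List (Vec Bool m) → ℤ
  Z₀ π = ∏ π μ * ∏ π (λ B → N (false ∷ B))
  Z : List (Vec Bool m) → Fin m → ℤ
  Z π i = ∏ π μ * ∏ π (λ B → N (lookup B i ∷ B))

-- Injective words avoiding forbidden positions

fresh : ∀ {n m} → Fin n → Vec (Fin n) m → Bool
fresh y []      = true
fresh y (z ∷ c) = not (does (y ≟F z)) ∧ fresh y c

distinct : ∀ {n m} → Vec (Fin n) m → Bool
distinct []      = true
distinct (y ∷ c) = fresh y c ∧ distinct c

-- τ x ∈ {0,1}^m marks the positions at which the letter x is forbidden.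
avoids : ∀ {n m} → (Fin n → Vec Bool m) → Vec (Fin n) m → ℤ
avoids τ []      = + 1
avoids τ (y ∷ c) = ⟦ not (Vec.head (τ y)) ⟧ * avoids (λ x → Vec.tail (τ x)) c

injAvoiding : ∀ {n} m → (Fin n → Vec Bool m) → ℤ
injAvoiding {n} m τ = ∑ (allVecs (allFin n) m) (λ c → ⟦ distinct c ⟧ * avoids τ c)

allowedOn : ∀ {n m} → (Fin n → Vec Bool m) → Vec Bool m → ℤ
allowedOn {n} τ B = ∑ᶠ n (λ x → ⟦ ZeroOn B (τ x) ⟧)

fresh-occurrences : ∀ {n m} (y : Fin n) (c : Vec (Fin n) m) → T (fresh y c) →
                    ∑ᶠ m (λ k → ⟦ does (y ≟F lookup c k) ⟧) ≡ + 0
fresh-occurrences y []      e = refl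
fresh-occurrences y (z ∷ c) e with y ≟F z
fresh-occurrences y (z ∷ c) () | yes _
... | no _ = trans (ℤP.+-identityˡ _) (fresh-occurrences y c e)

⟦fresh⟧ : ∀ {n m} (y : Fin n) (c : Vec (Fin n) m) → T (distinct c) →
          ⟦ fresh y c ⟧ ≡ + 1 - ∑ᶠ m (λ k → ⟦ does (y ≟F lookup c k) ⟧)
⟦fresh⟧ y []      _    = refl
⟦fresh⟧ y (z ∷ c) dist with y ≟F z | Equivalence.to (T-∧ {fresh z c} {distinct c}) dist
... | yes refl | fresh-y , _ = sym (cong (λ s → + 1 - (+ 1 + s)) (fresh-occurrences y c fresh-y))
... | no _     | _ , dist′   = trans (⟦fresh⟧ y c dist′)
                   (cong (λ s → + 1 - s) (sym (ℤP.+-identityˡ (∑ᶠ _ (λ k → ⟦ does (y ≟F lookup c k) ⟧)))))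

∑ᶠ-fresh : ∀ {n m} (a : Fin n → ℤ) (c : Vec (Fin n) m) → T (distinct c) →
           ∑ᶠ n (λ y → a y * ⟦ fresh y c ⟧) ≡ ∑ᶠ n a - ∑ᶠ m (λ k → a (lookup c k))
∑ᶠ-fresh {n} {m} a c dist = begin
    ∑ᶠ n (λ y → a y * ⟦ fresh y c ⟧)
  ≡⟨ ∑ᶠ-cong n (λ y → trans (cong (a y *_) (⟦fresh⟧ y c dist))
                      (solve 2 (λ a s → a :* (con (+ 1) :- s) := a :+ :- (a :* s)) refl (a y) (occ y))) ⟩
    ∑ᶠ n (λ y → a y + - (a y * occ y))
  ≡⟨ ∑ᶠ-distrib-+ n a _ ⟩
    ∑ᶠ n a + ∑ᶠ n (λ y → - (a y * occ y))
  ≡⟨ cong (_+_ (∑ᶠ n a)) (trans (∑ᶠ-neg n _) (cong -_ (begin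
      ∑ᶠ n (λ y → a y * occ y)
    ≡⟨ ∑ᶠ-cong n (λ y → sym (∑ᶠ-*ˡ m (a y) _)) ⟩
      ∑ᶠ n (λ y → ∑ᶠ m (λ k → a y * ⟦ does (y ≟F lookup c k) ⟧))
    ≡⟨ ∑ᶠ-comm n m _ ⟩
      ∑ᶠ m (λ k → ∑ᶠ n (λ y → a y * ⟦ does (y ≟F lookup c k) ⟧))
    ≡⟨ ∑ᶠ-cong m (λ k → trans (∑ᶠ-cong n (λ y → ℤP.*-comm (a y) _)) (∑ᶠ-pick n a (lookup c k))) ⟩
      ∑ᶠ m (λ k → a (lookup c k))
    ∎))) ⟩
    ∑ᶠ n a - ∑ᶠ m (λ k → a (lookup c k))
  ∎
  where
  open ≡-Reasoning
  occ : Fin _ → ℤ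
  occ y = ∑ᶠ m (λ k → ⟦ does (y ≟F lookup c k) ⟧)

orAt : ∀ {m} → Fin m → Bool → Vec Bool m → Vec Bool m
orAt Fin.zero    b v = (Vec.head v ∨ b) ∷ Vec.tail v
orAt (Fin.suc k) b v = Vec.head v ∷ orAt k b (Vec.tail v)

-- Moves the constraint at position 0 to position k.
mergeInto : ∀ {n m} → Fin m → (Fin n → Vec Bool (suc m)) → Fin n → Vec Bool m
mergeInto k τ x = orAt k (Vec.head (τ x)) (Vec.tail (τ x))

ZeroOn-∷ : ∀ {m} b x (B v : Vec Bool m) → ZeroOn (b ∷ B) (x ∷ v) ≡ not (b ∧ x) ∧ ZeroOn B v
ZeroOn-∷ true  true  B v = refl
ZeroOn-∷ true  false B v = refl
ZeroOn-∷ false x     B v = refl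

∧-left-comm : ∀ p q z → p ∧ (q ∧ z) ≡ q ∧ (p ∧ z)
∧-left-comm p q z = trans (sym (∧-assoc p q z)) (trans (cong (_∧ z) (∧-comm p q)) (∧-assoc q p z))

ZeroOn-orAt : ∀ {m} (B : Vec Bool m) (k : Fin m) (a : Bool) (v : Vec Bool m) →
              ZeroOn B (orAt k a v) ≡ ZeroOn (lookup B k ∷ B) (a ∷ v)
ZeroOn-orAt (b ∷ B) Fin.zero a (x ∷ v) = begin
    ZeroOn (b ∷ B) ((x ∨ a) ∷ v)
  ≡⟨ ZeroOn-∷ b (x ∨ a) B v ⟩
    not (b ∧ (x ∨ a)) ∧ ZeroOn B v
  ≡⟨ cong (_∧ ZeroOn B v) (not-∧-∨ b x a) ⟩
    (not (b ∧ a) ∧ not (b ∧ x)) ∧ ZeroOn B v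
  ≡⟨ ∧-assoc (not (b ∧ a)) (not (b ∧ x)) (ZeroOn B v) ⟩
    not (b ∧ a) ∧ (not (b ∧ x) ∧ ZeroOn B v)
  ≡⟨ sym (trans (ZeroOn-∷ b a (b ∷ B) (x ∷ v)) (cong (not (b ∧ a) ∧_) (ZeroOn-∷ b x B v))) ⟩
    ZeroOn (b ∷ b ∷ B) (a ∷ x ∷ v)
  ∎
  where
  open ≡-Reasoning
  not-∧-∨ : ∀ b x a → not (b ∧ (x ∨ a)) ≡ not (b ∧ a) ∧ not (b ∧ x)
  not-∧-∨ false x     a = refl
  not-∧-∨ true  true  a = sym (∧-zeroʳ (not a))
  not-∧-∨ true  false a = sym (∧-identityʳ (not a))
ZeroOn-orAt (c ∷ B) (Fin.suc k) a (x ∷ v) = begin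
    ZeroOn (c ∷ B) (x ∷ orAt k a v)
  ≡⟨ ZeroOn-∷ c x B (orAt k a v) ⟩
    not (c ∧ x) ∧ ZeroOn B (orAt k a v)
  ≡⟨ cong (not (c ∧ x) ∧_) (trans (ZeroOn-orAt B k a v) (ZeroOn-∷ (lookup B k) a B v)) ⟩
    not (c ∧ x) ∧ (not (lookup B k ∧ a) ∧ ZeroOn B v)
  ≡⟨ ∧-left-comm (not (c ∧ x)) (not (lookup B k ∧ a)) (ZeroOn B v) ⟩
    not (lookup B k ∧ a) ∧ (not (c ∧ x) ∧ ZeroOn B v)
  ≡⟨ sym (trans (ZeroOn-∷ (lookup B k) a (c ∷ B) (x ∷ v)) (cong (not (lookup B k ∧ a) ∧_) (ZeroOn-∷ c x B v))) ⟩
    ZeroOn (lookup B k ∷ c ∷ B) (a ∷ x ∷ v)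
  ∎
  where open ≡-Reasoning

ZeroOn-e₀ : ∀ {m} (v : Vec Bool (suc m)) → ZeroOn e₀ v ≡ not (Vec.head v)
ZeroOn-e₀ (true  ∷ v) = refl
ZeroOn-e₀ (false ∷ v) = ZeroOn-replicate-false v
  where
  ZeroOn-replicate-false : ∀ {m} (v : Vec Bool m) → ZeroOn (Vec.replicate m false) v ≡ true
  ZeroOn-replicate-false []      = refl
  ZeroOn-replicate-false (_ ∷ v) = ZeroOn-replicate-false v

allowedOn-e₀ : ∀ {n m} (τ : Fin n → Vec Bool (suc m)) → allowedOn τ e₀ ≡ ∑ᶠ n (λ y → ⟦ not (Vec.head (τ y)) ⟧)
allowedOn-e₀ {n} τ = ∑ᶠ-cong n (λ x → cong ⟦_⟧ (ZeroOn-e₀ (τ x)))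

allowedOn-tail : ∀ {n m} (τ : Fin n → Vec Bool (suc m)) B →
                 allowedOn (λ x → Vec.tail (τ x)) B ≡ allowedOn τ (false ∷ B)
allowedOn-tail {n} τ B = ∑ᶠ-cong n (λ x → cong ⟦_⟧ (ZeroOn-tail (τ x)))
  where
  ZeroOn-tail : (v : Vec Bool _) → ZeroOn B (Vec.tail v) ≡ ZeroOn (false ∷ B) v
  ZeroOn-tail (_ ∷ v) = refl

allowedOn-mergeInto : ∀ {n m} (k : Fin m) (τ : Fin n → Vec Bool (suc m)) B →
                      allowedOn (mergeInto k τ) B ≡ allowedOn τ (lookup B k ∷ B)
allowedOn-mergeInto {n} k τ B = ∑ᶠ-cong n (λ x → cong ⟦_⟧ (ZeroOn-merge (τ x)))
  where
  ZeroOn-merge : (v : Vec Bool _) → ZeroOn B (orAt k (Vec.head v) (Vec.tail v)) ≡ ZeroOn (lookup B k ∷ B) v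
  ZeroOn-merge (a ∷ v) = ZeroOn-orAt B k a v

avoids-orAt : ∀ {n m} (σ : Fin n → Vec Bool m) (h : Fin n → Bool) (k : Fin m) (c : Vec (Fin n) m) →
              avoids σ c * ⟦ not (h (lookup c k)) ⟧ ≡ avoids (λ x → orAt k (h x) (σ x)) c
avoids-orAt σ h Fin.zero (y ∷ c) = begin
    ⟦ not (Vec.head (σ y)) ⟧ * avoids σ′ c * ⟦ not (h y) ⟧
  ≡⟨ solve 3 (λ a v b → a :* v :* b := a :* b :* v) refl ⟦ not (Vec.head (σ y)) ⟧ (avoids σ′ c) ⟦ not (h y) ⟧ ⟩
    ⟦ not (Vec.head (σ y)) ⟧ * ⟦ not (h y) ⟧ * avoids σ′ c
  ≡⟨ cong (_* avoids σ′ c) (sym (⟦not∨⟧ (Vec.head (σ y)) (h y))) ⟩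
    ⟦ not (Vec.head (σ y) ∨ h y) ⟧ * avoids σ′ c
  ∎
  where
  open ≡-Reasoning
  σ′ = λ x → Vec.tail (σ x)
avoids-orAt σ h (Fin.suc k) (y ∷ c) = trans (ℤP.*-assoc ⟦ not (Vec.head (σ y)) ⟧ _ _)
  (cong (⟦ not (Vec.head (σ y)) ⟧ *_) (avoids-orAt (λ x → Vec.tail (σ x)) h k c))

indicator-cong : ∀ b {x y : ℤ} → (T b → x ≡ y) → ⟦ b ⟧ * x ≡ ⟦ b ⟧ * y
indicator-cong true  e = cong (+ 1 *_) (e _)
indicator-cong false e = refl

-- The first letter y must be allowed at position 0 and differ from every c k; the letters
-- c k that are allowed at 0 are counted by moving the position-0 constraint to position k.
∑-first-letter : ∀ {n m} (τ : Fin n → Vec Bool (suc m)) (c : Vec (Fin n) m) →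
  ∑ (allFin n) (λ y → ⟦ distinct (y ∷ c) ⟧ * avoids τ (y ∷ c))
  ≡ allowedOn τ e₀ * (⟦ distinct c ⟧ * avoids (λ x → Vec.tail (τ x)) c)
    - ∑ᶠ m (λ k → ⟦ distinct c ⟧ * avoids (mergeInto k τ) c)
∑-first-letter {n} {m} τ c = begin
    ∑ (allFin n) (λ y → ⟦ fresh y c ∧ distinct c ⟧ * (⟦ A y ⟧ * avoids σ c))
  ≡⟨ ∑-cong (allFin n) (λ y → trans (cong (_* (⟦ A y ⟧ * avoids σ c)) (⟦∧⟧ (fresh y c) (distinct c)))
       (solve 4 (λ f d a v → (f :* d) :* (a :* v) := (d :* v) :* (a :* f)) refl
          ⟦ fresh y c ⟧ ⟦ distinct c ⟧ ⟦ A y ⟧ (avoids σ c))) ⟩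
    ∑ (allFin n) (λ y → ⟦ distinct c ⟧ * avoids σ c * (⟦ A y ⟧ * ⟦ fresh y c ⟧))
  ≡⟨ trans (∑-*ˡ (allFin n) (⟦ distinct c ⟧ * avoids σ c) _)
           (cong (⟦ distinct c ⟧ * avoids σ c *_) (∑-allFin n _)) ⟩
    ⟦ distinct c ⟧ * avoids σ c * ∑ᶠ n (λ y → ⟦ A y ⟧ * ⟦ fresh y c ⟧)
  ≡⟨ trans (ℤP.*-assoc ⟦ distinct c ⟧ _ _)
           (indicator-cong (distinct c) (λ dist → cong (avoids σ c *_) (∑ᶠ-fresh (λ y → ⟦ A y ⟧) c dist))) ⟩
    ⟦ distinct c ⟧ * (avoids σ c * (NA - ∑ᶠ m (λ k → ⟦ A (lookup c k) ⟧)))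
  ≡⟨ solve 4 (λ d v a s → d :* (v :* (a :- s)) := a :* (d :* v) :- d :* (v :* s)) refl
       ⟦ distinct c ⟧ (avoids σ c) NA (∑ᶠ m (λ k → ⟦ A (lookup c k) ⟧)) ⟩
    NA * (⟦ distinct c ⟧ * avoids σ c) - ⟦ distinct c ⟧ * (avoids σ c * ∑ᶠ m (λ k → ⟦ A (lookup c k) ⟧))
  ≡⟨ cong₂ (λ a r → a * (⟦ distinct c ⟧ * avoids σ c) - r) (sym (allowedOn-e₀ τ)) (begin
      ⟦ distinct c ⟧ * (avoids σ c * ∑ᶠ m (λ k → ⟦ A (lookup c k) ⟧))
    ≡⟨ cong (⟦ distinct c ⟧ *_) (trans (sym (∑ᶠ-*ˡ m (avoids σ c) _))
                                      (∑ᶠ-cong m (λ k → avoids-orAt σ (λ x → Vec.head (τ x)) k c))) ⟩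
      ⟦ distinct c ⟧ * ∑ᶠ m (λ k → avoids (mergeInto k τ) c)
    ≡⟨ sym (∑ᶠ-*ˡ m ⟦ distinct c ⟧ _) ⟩
      ∑ᶠ m (λ k → ⟦ distinct c ⟧ * avoids (mergeInto k τ) c)
    ∎) ⟩
    allowedOn τ e₀ * (⟦ distinct c ⟧ * avoids σ c) - ∑ᶠ m (λ k → ⟦ distinct c ⟧ * avoids (mergeInto k τ) c)
  ∎
  where
  open ≡-Reasoning
  σ : Fin n → Vec Bool m
  σ x = Vec.tail (τ x)
  A : Fin n → Bool
  A y = not (Vec.head (τ y))
  NA : ℤ
  NA = ∑ᶠ n (λ y → ⟦ A y ⟧)

injAvoiding-suc : ∀ {n} m (τ : Fin n → Vec Bool (suc m)) →
  injAvoiding (suc m) τ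
  ≡ allowedOn τ e₀ * injAvoiding m (λ x → Vec.tail (τ x)) - ∑ᶠ m (λ k → injAvoiding m (mergeInto k τ))
injAvoiding-suc {n} m τ = begin
    injAvoiding (suc m) τ
  ≡⟨ ∑-allVecs-suc (allFin n) m (λ c → ⟦ distinct c ⟧ * avoids τ c) ⟩
    ∑ (allFin n) (λ y → ∑ words (λ c → ⟦ distinct (y ∷ c) ⟧ * avoids τ (y ∷ c)))
  ≡⟨ ∑-comm (allFin n) words (λ y c → ⟦ distinct (y ∷ c) ⟧ * avoids τ (y ∷ c)) ⟩
    ∑ words (λ c → ∑ (allFin n) (λ y → ⟦ distinct (y ∷ c) ⟧ * avoids τ (y ∷ c)))
  ≡⟨ ∑-cong words (∑-first-letter τ) ⟩
    ∑ words (λ c → allowedOn τ e₀ * (⟦ distinct c ⟧ * avoids σ c) + - ∑ᶠ m (merged c))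
  ≡⟨ ∑-distrib-+ words (λ c → allowedOn τ e₀ * (⟦ distinct c ⟧ * avoids σ c)) (λ c → - ∑ᶠ m (merged c)) ⟩
    ∑ words (λ c → allowedOn τ e₀ * (⟦ distinct c ⟧ * avoids σ c))
      + ∑ words (λ c → - ∑ᶠ m (merged c))
  ≡⟨ cong₂ _+_ (∑-*ˡ words (allowedOn τ e₀) _)
               (trans (∑-neg words (λ c → ∑ᶠ m (merged c))) (cong -_ (∑-∑ᶠ-comm words m merged))) ⟩
    allowedOn τ e₀ * injAvoiding m σ - ∑ᶠ m (λ k → injAvoiding m (mergeInto k τ))
  ∎
  where
  open ≡-Reasoning
  words = allVecs (allFin n) m
  σ : Fin n → Vec Bool m
  σ x = Vec.tail (τ x)
  merged : Vec (Fin n) m → Fin m → ℤ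
  merged c k = ⟦ distinct c ⟧ * avoids (mergeInto k τ) c

injAvoiding≡partitionSum : ∀ {n} m (τ : Fin n → Vec Bool m) → injAvoiding m τ ≡ partitionSum m (allowedOn τ)
injAvoiding≡partitionSum zero    τ = refl
injAvoiding≡partitionSum (suc m) τ = begin
    injAvoiding (suc m) τ
  ≡⟨ injAvoiding-suc m τ ⟩
    allowedOn τ e₀ * injAvoiding m (λ x → Vec.tail (τ x)) - ∑ᶠ m (λ k → injAvoiding m (mergeInto k τ))
  ≡⟨ cong₂ (λ u v → allowedOn τ e₀ * u - v)
       (trans (injAvoiding≡partitionSum m _) (partitionSum-cong m (allowedOn-tail τ)))
       (∑ᶠ-cong m (λ k → trans (injAvoiding≡partitionSum m _) (partitionSum-cong m (allowedOn-mergeInto k τ)))) ⟩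
    allowedOn τ e₀ * partitionSum m (λ B → allowedOn τ (false ∷ B))
      - ∑ᶠ m (λ k → partitionSum m (λ B → allowedOn τ (lookup B k ∷ B)))
  ≡⟨ sym (partitionSum-suc m (allowedOn τ)) ⟩
    partitionSum (suc m) (allowedOn τ)
  ∎
  where open ≡-Reasoning

-- Binomial and multinomial coefficients

∑splits : ℕ → (ℕ → ℕ → ℤ) → ℤ
∑splits zero    H = H 0 0
∑splits (suc n) H = H 0 (suc n) + ∑splits n (λ a b → H (suc a) b)

∑splits-cong : ∀ n {H H′ : ℕ → ℕ → ℤ} → (∀ a b → H a b ≡ H′ a b) → ∑splits n H ≡ ∑splits n H′
∑splits-cong zero    e = e 0 0
∑splits-cong (suc n) e = cong₂ _+_ (e 0 (suc n)) (∑splits-cong n (λ a b → e (suc a) b))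

∑splits-distrib-+ : ∀ n (H H′ : ℕ → ℕ → ℤ) →
                    ∑splits n (λ a b → H a b + H′ a b) ≡ ∑splits n H + ∑splits n H′
∑splits-distrib-+ zero    H H′ = refl
∑splits-distrib-+ (suc n) H H′ =
  trans (cong (_+_ (H 0 (suc n) + H′ 0 (suc n))) (∑splits-distrib-+ n (λ a b → H (suc a) b) (λ a b → H′ (suc a) b)))
        (solve 4 (λ a b c d → (a :+ b) :+ (c :+ d) := (a :+ c) :+ (b :+ d)) refl (H 0 (suc n)) (H′ 0 (suc n)) _ _)

∑splits-∑ : ∀ {a} {A : Set a} n (xs : List A) (H : A → ℕ → ℕ → ℤ) →
            ∑splits n (λ a b → ∑ xs (λ x → H x a b)) ≡ ∑ xs (λ x → ∑splits n (H x))
∑splits-∑ n []       H = ∑splits-zero n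
  where
  ∑splits-zero : ∀ n → ∑splits n (λ _ _ → + 0) ≡ + 0
  ∑splits-zero zero    = refl
  ∑splits-zero (suc n) = trans (ℤP.+-identityˡ _) (∑splits-zero n)
∑splits-∑ n (x ∷ xs) H = trans (∑splits-distrib-+ n (H x) (λ a b → ∑ xs (λ x → H x a b)))
                               (cong (_+_ (∑splits n (H x))) (∑splits-∑ n xs H))

shift₁ shift₂ : (ℕ → ℕ → ℤ) → ℕ → ℕ → ℤ
shift₁ X zero    b       = + 0
shift₁ X (suc a) b       = X a b
shift₂ X a       zero    = + 0
shift₂ X a       (suc b) = X a b

∑splits-shift₁ : ∀ n X → ∑splits (suc n) (shift₁ X) ≡ ∑splits n X
∑splits-shift₁ n X = trans (ℤP.+-identityˡ _) (∑splits-cong n (λ a b → refl))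

∑splits-shift₂ : ∀ n X → ∑splits (suc n) (shift₂ X) ≡ ∑splits n X
∑splits-shift₂ zero    X = ℤP.+-identityʳ _
∑splits-shift₂ (suc n) X = cong (_+_ (X 0 (suc n)))
  (trans (∑splits-cong (suc n) shift₂-suc) (∑splits-shift₂ n (λ a b → X (suc a) b)))
  where
  shift₂-suc : ∀ a b → shift₂ X (suc a) b ≡ shift₂ (λ a b → X (suc a) b) a b
  shift₂-suc a zero    = refl
  shift₂-suc a (suc b) = refl

-- binom a b is the binomial coefficient (a + b choose a).
binom : ℕ → ℕ → ℕ
binom zero    b       = 1
binom (suc a) zero    = 1
binom (suc a) (suc b) = binom a (suc b) ℕ.+ binom (suc a) b

binom-! : ∀ a b → binom a b ℕ.* (a ! ℕ.* b !) ≡ (a ℕ.+ b) !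
binom-! zero    b       = trans (ℕP.*-identityˡ _) (ℕP.*-identityˡ _)
binom-! (suc a) zero    = trans (ℕP.*-identityˡ _) (trans (ℕP.*-identityʳ _) (cong _! (sym (ℕP.+-identityʳ (suc a)))))
binom-! (suc a) (suc b) = begin
    (binom a (suc b) ℕ.+ binom (suc a) b) ℕ.* (suc a ! ℕ.* suc b !)
  ≡⟨ ℕP.*-distribʳ-+ (suc a ! ℕ.* suc b !) (binom a (suc b)) (binom (suc a) b) ⟩
    binom a (suc b) ℕ.* (suc a ! ℕ.* suc b !) ℕ.+ binom (suc a) b ℕ.* (suc a ! ℕ.* suc b !)
  ≡⟨ cong₂ ℕ._+_
       (NS.solve 4 (λ B a fa fb → B NS.:* ((NS.con 1 NS.:+ a) NS.:* fa NS.:* fb)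
                                    NS.:= (NS.con 1 NS.:+ a) NS.:* (B NS.:* (fa NS.:* fb))) refl (binom a (suc b)) a (a !) (suc b !))
       (NS.solve 4 (λ B b fa fb → B NS.:* (fa NS.:* ((NS.con 1 NS.:+ b) NS.:* fb))
                                    NS.:= (NS.con 1 NS.:+ b) NS.:* (B NS.:* (fa NS.:* fb))) refl (binom (suc a) b) b (suc a !) (b !)) ⟩
    suc a ℕ.* (binom a (suc b) ℕ.* (a ! ℕ.* suc b !)) ℕ.+ suc b ℕ.* (binom (suc a) b ℕ.* (suc a ! ℕ.* b !))
  ≡⟨ cong₂ (λ u v → suc a ℕ.* u ℕ.+ suc b ℕ.* v) (binom-! a (suc b)) (binom-! (suc a) b) ⟩
    suc a ℕ.* (a ℕ.+ suc b) ! ℕ.+ suc b ℕ.* (suc a ℕ.+ b) !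
  ≡⟨ cong (λ z → suc a ℕ.* z ! ℕ.+ suc b ℕ.* (suc a ℕ.+ b) !) (ℕP.+-suc a b) ⟩
    suc a ℕ.* (suc a ℕ.+ b) ! ℕ.+ suc b ℕ.* (suc a ℕ.+ b) !
  ≡⟨ sym (ℕP.*-distribʳ-+ ((suc a ℕ.+ b) !) (suc a) (suc b)) ⟩
    (suc a ℕ.+ suc b) ℕ.* (suc a ℕ.+ b) !
  ≡⟨ cong (λ z → (suc a ℕ.+ suc b) ℕ.* z !) (sym (ℕP.+-suc a b)) ⟩
    (suc a ℕ.+ suc b) !
  ∎
  where open ≡-Reasoning

-- Pascal's rule splits each term of the left-hand side between the two sums.
∑splits-pascal : ∀ n (H : ℕ → ℕ → ℤ) →
  ∑splits (suc n) (λ a b → + binom a b * H a b)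
  ≡ ∑splits n (λ a b → + binom a b * H a (suc b)) + ∑splits n (λ a b → + binom a b * H (suc a) b)
∑splits-pascal n H = begin
    ∑splits (suc n) (λ a b → + binom a b * H a b)
  ≡⟨ cong₂ _+_ (sym (ℤP.+-identityʳ (+ 1 * H 0 (suc n)))) (∑splits-cong n pascal) ⟩
    ∑splits (suc n) (λ a b → shift₂ X₁ a b + shift₁ X₂ a b)
  ≡⟨ ∑splits-distrib-+ (suc n) (shift₂ X₁) (shift₁ X₂) ⟩
    ∑splits (suc n) (shift₂ X₁) + ∑splits (suc n) (shift₁ X₂)
  ≡⟨ cong₂ _+_ (∑splits-shift₂ n X₁) (∑splits-shift₁ n X₂) ⟩
    ∑splits n X₁ + ∑splits n X₂
  ∎
  where
  open ≡-Reasoning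
  X₁ X₂ : ℕ → ℕ → ℤ
  X₁ a b = + binom a b * H a (suc b)
  X₂ a b = + binom a b * H (suc a) b
  pascal : ∀ a b → + binom (suc a) b * H (suc a) b ≡ shift₂ X₁ (suc a) b + shift₁ X₂ (suc a) b
  pascal zero    zero    = sym (ℤP.+-identityˡ _)
  pascal (suc a) zero    = sym (ℤP.+-identityˡ _)
  pascal a       (suc b) = begin
      + (binom a (suc b) ℕ.+ binom (suc a) b) * H (suc a) (suc b)
    ≡⟨ cong (_* H (suc a) (suc b)) (ℤP.pos-+ (binom a (suc b)) (binom (suc a) b)) ⟩
      (+ binom a (suc b) + + binom (suc a) b) * H (suc a) (suc b)
    ≡⟨ ℤP.*-distribʳ-+ (H (suc a) (suc b)) (+ binom a (suc b)) (+ binom (suc a) b) ⟩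
      X₂ a (suc b) + X₁ (suc a) b
    ≡⟨ ℤP.+-comm (X₂ a (suc b)) (X₁ (suc a) b) ⟩
      X₁ (suc a) b + X₂ a (suc b)
    ∎

join : ∀ {m} → (Vec Bool m → ℕ) → (Vec Bool m → ℕ) → Vec Bool (suc m) → ℕ
join s₀ s₁ (false ∷ ε) = s₀ ε
join s₀ s₁ (true  ∷ ε) = s₁ ε

join-cong : ∀ {m} {s₀ s₀′ s₁ s₁′ : Vec Bool m → ℕ} →
            (∀ δ → s₀ δ ≡ s₀′ δ) → (∀ δ → s₁ δ ≡ s₁′ δ) → ∀ δ → join s₀ s₁ δ ≡ join s₀′ s₁′ δ
join-cong e₀ e₁ (false ∷ ε) = e₀ ε
join-cong e₀ e₁ (true  ∷ ε) = e₁ ε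

factorials : ∀ {m} → (Vec Bool m → ℕ) → ℕ
factorials {m} s = prodFact (map s (cube m))

factorials-cong : ∀ {m} {s s′ : Vec Bool m → ℕ} → (∀ δ → s δ ≡ s′ δ) → factorials s ≡ factorials s′
factorials-cong {m} e = cong prodFact (LP.map-cong e (cube m))

prodFact-++ : ∀ xs ys → prodFact (xs ++ ys) ≡ prodFact xs ℕ.* prodFact ys
prodFact-++ []       ys = sym (ℕP.+-identityʳ _)
prodFact-++ (x ∷ xs) ys = trans (cong (x ! ℕ.*_) (prodFact-++ xs ys)) (sym (ℕP.*-assoc (x !) _ _))

factorials-join : ∀ {m} (s₀ s₁ : Vec Bool m → ℕ) →
                  factorials (join s₀ s₁) ≡ factorials s₁ ℕ.* (factorials s₀ ℕ.* 1)
factorials-join {m} s₀ s₁ = begin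
    prodFact (map (join s₀ s₁) (map (true ∷_) (cube m) ++ (map (false ∷_) (cube m) ++ [])))
  ≡⟨ cong prodFact (LP.map-++ (join s₀ s₁) (map (true ∷_) (cube m)) _) ⟩
    prodFact (map (join s₀ s₁) (map (true ∷_) (cube m)) ++ map (join s₀ s₁) (map (false ∷_) (cube m) ++ []))
  ≡⟨ prodFact-++ (map (join s₀ s₁) (map (true ∷_) (cube m))) _ ⟩
    prodFact (map (join s₀ s₁) (map (true ∷_) (cube m))) ℕ.* prodFact (map (join s₀ s₁) (map (false ∷_) (cube m) ++ []))
  ≡⟨ cong₂ ℕ._*_ (cong prodFact (sym (LP.map-∘ (cube m))))
       (trans (cong prodFact (LP.map-++ (join s₀ s₁) (map (false ∷_) (cube m)) []))
         (trans (prodFact-++ (map (join s₀ s₁) (map (false ∷_) (cube m))) [])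
           (cong (ℕ._* 1) (cong prodFact (sym (LP.map-∘ (cube m))))))) ⟩
    factorials s₁ ℕ.* (factorials s₀ ℕ.* 1)
  ∎
  where open ≡-Reasoning

multinomial-cong : ∀ {m} n {s s′ : Vec Bool m → ℕ} → (∀ δ → s δ ≡ s′ δ) → multinomial n s ≡ multinomial n s′
multinomial-cong {m} n {s} {s′} e =
  ℕD./-congʳ {{prodFact≢0 (map s (cube m))}} {{prodFact≢0 (map s′ (cube m))}} (factorials-cong e)

-- multinomial is a truncated division; on compositions of n it is exact.
-- (A record, so that s can be inferred from MultinomialExact n s.)
record MultinomialExact {m} (n : ℕ) (s : Vec Bool m → ℕ) : Set where
  constructor exact
  field multinomial*factorials : multinomial n s ℕ.* factorials s ≡ n !

multinomialExact-cong : ∀ {m} n {s s′ : Vec Bool m → ℕ} → (∀ δ → s δ ≡ s′ δ) →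
                        MultinomialExact n s → MultinomialExact n s′
multinomialExact-cong n e (exact eq) = exact (trans (cong₂ ℕ._*_ (sym (multinomial-cong n e)) (sym (factorials-cong e))) eq)

multinomial-join : ∀ {m} a b (s₀ s₁ : Vec Bool m → ℕ) → MultinomialExact a s₀ → MultinomialExact b s₁ →
                   multinomial (a ℕ.+ b) (join s₀ s₁) ≡ binom a b ℕ.* (multinomial a s₀ ℕ.* multinomial b s₁)
multinomial-join {m} a b s₀ s₁ (exact exact₀) (exact exact₁) =
  trans (ℕD./-congˡ {{prodFact≢0 (map (join s₀ s₁) (cube (suc m)))}} a+b!≡)
        (ℕD.m*n/n≡m X (factorials (join s₀ s₁)) {{prodFact≢0 (map (join s₀ s₁) (cube (suc m)))}})
  where
  M₀ = multinomial a s₀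
  M₁ = multinomial b s₁
  X = binom a b ℕ.* (M₀ ℕ.* M₁)
  a+b!≡ : (a ℕ.+ b) ! ≡ X ℕ.* factorials (join s₀ s₁)
  a+b!≡ = begin
      (a ℕ.+ b) !
    ≡⟨ sym (binom-! a b) ⟩
      binom a b ℕ.* (a ! ℕ.* b !)
    ≡⟨ cong₂ (λ u v → binom a b ℕ.* (u ℕ.* v)) (sym exact₀) (sym exact₁) ⟩
      binom a b ℕ.* ((M₀ ℕ.* factorials s₀) ℕ.* (M₁ ℕ.* factorials s₁))
    ≡⟨ NS.solve 5 (λ B m₀ p₀ m₁ p₁ → B NS.:* ((m₀ NS.:* p₀) NS.:* (m₁ NS.:* p₁))
                                     NS.:= (B NS.:* (m₀ NS.:* m₁)) NS.:* (p₁ NS.:* (p₀ NS.:* NS.con 1)))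
         refl (binom a b) M₀ (factorials s₀) M₁ (factorials s₁) ⟩
      X ℕ.* (factorials s₁ ℕ.* (factorials s₀ ℕ.* 1))
    ≡⟨ cong (X ℕ.*_) (sym (factorials-join s₀ s₁)) ⟩
      X ℕ.* factorials (join s₀ s₁)
    ∎
    where open ≡-Reasoning

multinomialExact-join : ∀ {m} a b (s₀ s₁ : Vec Bool m → ℕ) → MultinomialExact a s₀ → MultinomialExact b s₁ →
                        MultinomialExact (a ℕ.+ b) (join s₀ s₁)
multinomialExact-join a b s₀ s₁ (exact exact₀) (exact exact₁) = exact (begin
    multinomial (a ℕ.+ b) (join s₀ s₁) ℕ.* factorials (join s₀ s₁)
  ≡⟨ cong₂ ℕ._*_ (multinomial-join a b s₀ s₁ (exact exact₀) (exact exact₁)) (factorials-join s₀ s₁) ⟩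
    binom a b ℕ.* (multinomial a s₀ ℕ.* multinomial b s₁) ℕ.* (factorials s₁ ℕ.* (factorials s₀ ℕ.* 1))
  ≡⟨ NS.solve 5 (λ B m₀ p₀ m₁ p₁ → (B NS.:* (m₀ NS.:* m₁)) NS.:* (p₁ NS.:* (p₀ NS.:* NS.con 1))
                                   NS.:= B NS.:* ((m₀ NS.:* p₀) NS.:* (m₁ NS.:* p₁)))
       refl (binom a b) (multinomial a s₀) (factorials s₀) (multinomial b s₁) (factorials s₁) ⟩
    binom a b ℕ.* ((multinomial a s₀ ℕ.* factorials s₀) ℕ.* (multinomial b s₁ ℕ.* factorials s₁))
  ≡⟨ cong₂ (λ u v → binom a b ℕ.* (u ℕ.* v)) exact₀ exact₁ ⟩
    binom a b ℕ.* (a ! ℕ.* b !)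
  ≡⟨ binom-! a b ⟩
    (a ℕ.+ b) !
  ∎)
  where open ≡-Reasoning

multinomial-dim0 : ∀ n → multinomial {0} n (λ _ → n) ≡ 1
multinomial-dim0 n = trans (ℕD./-congˡ {{prodFact≢0 (n ∷ [])}} (sym (trans (ℕP.*-identityˡ _) (ℕP.*-identityʳ _))))
                           (ℕD.m*n/n≡m 1 (n ! ℕ.* 1) {{prodFact≢0 (n ∷ [])}})

comps-exact : ∀ m n → All (MultinomialExact n) (comps m n)
comps-exact zero    n =
  exact (trans (cong (ℕ._* (n ! ℕ.* 1)) (multinomial-dim0 n)) (trans (ℕP.*-identityˡ _) (ℕP.*-identityʳ _))) ∷ []
comps-exact (suc m) n =
  concat⁺ (map⁺ (applyUpTo⁺₁ (λ a → a) (suc n) (λ {a} a<1+n →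
    concat⁺ (map⁺ (All.map (λ {s₀} exact₀ → map⁺ (All.map (λ {s₁} exact₁ →
        multinomialExact-cong n (λ { (false ∷ ε) → refl ; (true ∷ ε) → refl })
          (subst (λ k → MultinomialExact k (join s₀ s₁)) (ℕP.m+[n∸m]≡n (ℕP.≤-pred a<1+n))
                 (multinomialExact-join a (n ∸ a) s₀ s₁ exact₀ exact₁)))
      (comps-exact m (n ∸ a)))) (comps-exact m a))))))

-- Words over the cube versus compositions

Extensional : ∀ {m} → ((Vec Bool m → ℕ) → ℤ) → Set
Extensional {m} F = ∀ (s s′ : Vec Bool m → ℕ) → (∀ δ → s δ ≡ s′ δ) → F s ≡ F s′

addUnit : ∀ {m} → Vec Bool m → (Vec Bool m → ℕ) → Vec Bool m → ℕ
addUnit x s δ = 𝟙 (does (δ ≟ᶜ x)) ℕ.+ s δ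

counts : ∀ {m n} → Vec (Vec Bool m) n → Vec Bool m → ℕ
counts []      = λ _ → 0
counts (x ∷ E) = addUnit x (counts E)

∑words : ∀ m n → ((Vec Bool m → ℕ) → ℤ) → ℤ
∑words m n F = ∑ (allVecs (cube m) n) (λ E → F (counts E))

∑comps : ∀ m n → ((Vec Bool m → ℕ) → ℤ) → ℤ
∑comps m n F = ∑ (comps m n) (λ s → + multinomial n s * F s)

∑comps-cong : ∀ m n {F F′ : (Vec Bool m → ℕ) → ℤ} → (∀ s → F s ≡ F′ s) → ∑comps m n F ≡ ∑comps m n F′
∑comps-cong m n e = ∑-cong (comps m n) (λ s → cong (+ multinomial n s *_) (e s))

∑comps-∑ : ∀ {a} {A : Set a} m n (xs : List A) (G : A → (Vec Bool m → ℕ) → ℤ) →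
           ∑comps m n (λ s → ∑ xs (λ x → G x s)) ≡ ∑ xs (λ x → ∑comps m n (G x))
∑comps-∑ m n xs G = trans (∑-cong (comps m n) (λ s → sym (∑-*ˡ xs (+ multinomial n s) (λ x → G x s))))
                          (∑-comm (comps m n) xs (λ s x → + multinomial n s * G x s))

module _ {m} (F : (Vec Bool (suc m) → ℕ) → ℤ) (ext : Extensional F) where

  extensional-join₀ : ∀ s₁ → Extensional (λ s₀ → F (join s₀ s₁))
  extensional-join₀ s₁ s s′ e = ext _ _ (join-cong e (λ _ → refl))

  extensional-join₁ : ∀ s₀ → Extensional (λ s₁ → F (join s₀ s₁))
  extensional-join₁ s₀ s s′ e = ext _ _ (join-cong (λ _ → refl) e)

  extensional-∑comps : ∀ b → Extensional (λ s₀ → ∑comps m b (λ s₁ → F (join s₀ s₁)))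
  extensional-∑comps b s s′ e = ∑comps-cong m b (λ s₁ → extensional-join₀ s₁ s s′ e)

extensional-addUnit : ∀ {m} (F : (Vec Bool m → ℕ) → ℤ) → Extensional F → ∀ x → Extensional (λ s → F (addUnit x s))
extensional-addUnit F ext x s s′ e = ext _ _ (λ δ → cong (𝟙 (does (δ ≟ᶜ x)) ℕ.+_) (e δ))

join-addUnit-true : ∀ {m} (x : Vec Bool m) s₀ s₁ δ → join s₀ (addUnit x s₁) δ ≡ addUnit (true ∷ x) (join s₀ s₁) δ
join-addUnit-true x s₀ s₁ (true  ∷ ε) = refl
join-addUnit-true x s₀ s₁ (false ∷ ε) = refl

join-addUnit-false : ∀ {m} (x : Vec Bool m) s₀ s₁ δ → join (addUnit x s₀) s₁ δ ≡ addUnit (false ∷ x) (join s₀ s₁) δ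
join-addUnit-false x s₀ s₁ (true  ∷ ε) = refl
join-addUnit-false x s₀ s₁ (false ∷ ε) = refl

∑-applyUpTo : ∀ k (f : ℕ → ℕ) (h : ℕ → ℤ) → ∑ (applyUpTo f k) h ≡ ∑ᶠ k (λ i → h (f (Fin.toℕ i)))
∑-applyUpTo zero    f h = refl
∑-applyUpTo (suc k) f h = cong (_+_ (h (f 0))) (∑-applyUpTo k (λ i → f (suc i)) h)

∑ᶠ-splits : ∀ n (h : ℕ → ℕ → ℕ → ℤ) →
            ∑ᶠ (suc n) (λ i → h n (Fin.toℕ i) (n ∸ Fin.toℕ i)) ≡ ∑splits n (λ a b → h (a ℕ.+ b) a b)
∑ᶠ-splits zero    h = ℤP.+-identityʳ _
∑ᶠ-splits (suc n) h = cong (_+_ (h (suc n) 0 (suc n))) (∑ᶠ-splits n (λ k a b → h (suc k) (suc a) b))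

∑comps-unfold : ∀ m n (h : (Vec Bool (suc m) → ℕ) → ℤ) → Extensional h →
  ∑ (comps (suc m) n) h
  ≡ ∑ᶠ (suc n) (λ i → ∑ (comps m (Fin.toℕ i)) (λ s₀ → ∑ (comps m (n ∸ Fin.toℕ i)) (λ s₁ → h (join s₀ s₁))))
∑comps-unfold m n h ext =
  trans (unfold _ (λ a s₀ s₁ → λ { (false ∷ ε) → refl ; (true ∷ ε) → refl }))
        (∑-applyUpTo (suc n) (λ a → a) (λ a → ∑ (comps m a) (λ s₀ → ∑ (comps m (n ∸ a)) (λ s₁ → h (join s₀ s₁)))))
  where
  -- The pairing function of comps is an anonymous pattern lambda, hence abstracted as J.
  unfold : (J : ℕ → (Vec Bool m → ℕ) → (Vec Bool m → ℕ) → Vec Bool (suc m) → ℕ) →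
           (∀ a s₀ s₁ δ → J a s₀ s₁ δ ≡ join s₀ s₁ δ) →
    ∑ (concatMap (λ a → concatMap (λ s₀ → map (J a s₀) (comps m (n ∸ a))) (comps m a)) (upTo (suc n))) h
    ≡ ∑ (upTo (suc n)) (λ a → ∑ (comps m a) (λ s₀ → ∑ (comps m (n ∸ a)) (λ s₁ → h (join s₀ s₁))))
  unfold J J≗join =
    trans (∑-concatMap (λ a → concatMap (λ s₀ → map (J a s₀) (comps m (n ∸ a))) (comps m a)) (upTo (suc n)) h)
      (∑-cong (upTo (suc n)) (λ a → trans (∑-concatMap (λ s₀ → map (J a s₀) (comps m (n ∸ a))) (comps m a) h)
        (∑-cong (comps m a) (λ s₀ → trans (∑-map (J a s₀) (comps m (n ∸ a)) h)
          (∑-cong (comps m (n ∸ a)) (λ s₁ → ext _ _ (J≗join a s₀ s₁)))))))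

∑comps-join : ∀ m a b (F : (Vec Bool (suc m) → ℕ) → ℤ) →
  ∑ (comps m a) (λ s₀ → ∑ (comps m b) (λ s₁ → + multinomial (a ℕ.+ b) (join s₀ s₁) * F (join s₀ s₁)))
  ≡ + binom a b * ∑comps m a (λ s₀ → ∑comps m b (λ s₁ → F (join s₀ s₁)))
∑comps-join m a b F = begin
    ∑ (comps m a) (λ s₀ → ∑ (comps m b) (λ s₁ → + multinomial (a ℕ.+ b) (join s₀ s₁) * F (join s₀ s₁)))
  ≡⟨ ∑-cong-All (comps-exact m a) (λ {s₀} exact₀ → ∑-cong-All (comps-exact m b) (λ {s₁} exact₁ →
       term s₀ s₁ (multinomial-join a b s₀ s₁ exact₀ exact₁))) ⟩
    ∑ (comps m a) (λ s₀ → ∑ (comps m b) (λ s₁ → + binom a b * (+ multinomial a s₀ * (+ multinomial b s₁ * F (join s₀ s₁)))))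
  ≡⟨ ∑-cong (comps m a) (λ s₀ → trans (∑-*ˡ (comps m b) (+ binom a b) _)
                                  (cong (+ binom a b *_) (∑-*ˡ (comps m b) (+ multinomial a s₀) _))) ⟩
    ∑ (comps m a) (λ s₀ → + binom a b * (+ multinomial a s₀ * ∑comps m b (λ s₁ → F (join s₀ s₁))))
  ≡⟨ ∑-*ˡ (comps m a) (+ binom a b) _ ⟩
    + binom a b * ∑comps m a (λ s₀ → ∑comps m b (λ s₁ → F (join s₀ s₁)))
  ∎
  where
  open ≡-Reasoning
  term : ∀ s₀ s₁ → multinomial (a ℕ.+ b) (join s₀ s₁) ≡ binom a b ℕ.* (multinomial a s₀ ℕ.* multinomial b s₁) →
         + multinomial (a ℕ.+ b) (join s₀ s₁) * F (join s₀ s₁)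
         ≡ + binom a b * (+ multinomial a s₀ * (+ multinomial b s₁ * F (join s₀ s₁)))
  term s₀ s₁ eq = begin
      + multinomial (a ℕ.+ b) (join s₀ s₁) * F (join s₀ s₁)
    ≡⟨ cong (_* F (join s₀ s₁)) (trans (cong +_ eq)
         (trans (ℤP.pos-* (binom a b) _) (cong (+ binom a b *_) (ℤP.pos-* (multinomial a s₀) (multinomial b s₁))))) ⟩
      + binom a b * (+ multinomial a s₀ * + multinomial b s₁) * F (join s₀ s₁)
    ≡⟨ solve 4 (λ B m₀ m₁ f → (B :* (m₀ :* m₁)) :* f := B :* (m₀ :* (m₁ :* f))) refl
         (+ binom a b) (+ multinomial a s₀) (+ multinomial b s₁) (F (join s₀ s₁)) ⟩
      + binom a b * (+ multinomial a s₀ * (+ multinomial b s₁ * F (join s₀ s₁)))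
    ∎

∑comps-suc-dim : ∀ m n (F : (Vec Bool (suc m) → ℕ) → ℤ) → Extensional F →
  ∑comps (suc m) n F ≡ ∑splits n (λ a b → + binom a b * ∑comps m a (λ s₀ → ∑comps m b (λ s₁ → F (join s₀ s₁))))
∑comps-suc-dim m n F ext = begin
    ∑comps (suc m) n F
  ≡⟨ ∑comps-unfold m n (λ s → + multinomial n s * F s)
       (λ s s′ e → cong₂ (λ u v → + u * v) (multinomial-cong n e) (ext s s′ e)) ⟩
    ∑ᶠ (suc n) (λ i → H n (Fin.toℕ i) (n ∸ Fin.toℕ i))
  ≡⟨ ∑ᶠ-splits n H ⟩
    ∑splits n (λ a b → H (a ℕ.+ b) a b)
  ≡⟨ ∑splits-cong n (λ a b → ∑comps-join m a b F) ⟩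
    ∑splits n (λ a b → + binom a b * ∑comps m a (λ s₀ → ∑comps m b (λ s₁ → F (join s₀ s₁))))
  ∎
  where
  open ≡-Reasoning
  H : ℕ → ℕ → ℕ → ℤ
  H k a b = ∑ (comps m a) (λ s₀ → ∑ (comps m b) (λ s₁ → + multinomial k (join s₀ s₁) * F (join s₀ s₁)))

∑comps-zero : ∀ m (F : (Vec Bool m → ℕ) → ℤ) → Extensional F → ∑comps m 0 F ≡ F (λ _ → 0)
∑comps-zero zero    F ext = trans (ℤP.+-identityʳ _) (ℤP.*-identityˡ _)
∑comps-zero (suc m) F ext = begin
    ∑comps (suc m) 0 F
  ≡⟨ trans (∑comps-suc-dim m 0 F ext) (ℤP.*-identityˡ _) ⟩
    ∑comps m 0 (λ s₀ → ∑comps m 0 (λ s₁ → F (join s₀ s₁)))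
  ≡⟨ ∑comps-cong m 0 (λ s₀ → ∑comps-zero m _ (extensional-join₁ F ext s₀)) ⟩
    ∑comps m 0 (λ s₀ → F (join s₀ (λ _ → 0)))
  ≡⟨ ∑comps-zero m _ (extensional-join₀ F ext (λ _ → 0)) ⟩
    F (join (λ _ → 0) (λ _ → 0))
  ≡⟨ ext _ _ (λ { (false ∷ ε) → refl ; (true ∷ ε) → refl }) ⟩
    F (λ _ → 0)
  ∎
  where open ≡-Reasoning

-- The multinomial recurrence (n+1 choose s) = ∑_x (n choose s − e_x).
∑comps-suc : ∀ m n (F : (Vec Bool m → ℕ) → ℤ) → Extensional F →
             ∑comps m (suc n) F ≡ ∑ (cube m) (λ x → ∑comps m n (λ s → F (addUnit x s)))
∑comps-suc zero n F ext =
  trans (cong (_+ + 0) (cong₂ (λ u v → + u * v) (trans (multinomial-dim0 (suc n)) (sym (multinomial-dim0 n)))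
                                                (ext _ _ (λ { [] → refl }))))
        (sym (ℤP.+-identityʳ _))
∑comps-suc (suc m) n F ext = begin
    ∑comps (suc m) (suc n) F
  ≡⟨ ∑comps-suc-dim m (suc n) F ext ⟩
    ∑splits (suc n) (λ a b → + binom a b * H a b F)
  ≡⟨ ∑splits-pascal n (λ a b → H a b F) ⟩
    ∑splits n (λ a b → + binom a b * H a (suc b) F) + ∑splits n (λ a b → + binom a b * H (suc a) b F)
  ≡⟨ cong₂ _+_ (∑splits-cong n (λ a b → cong (+ binom a b *_) (remove-from₁ a b)))
               (∑splits-cong n (λ a b → cong (+ binom a b *_) (remove-from₀ a b))) ⟩
    ∑splits n (λ a b → + binom a b * ∑ (cube m) (λ x → H a b (F∘addUnit (true ∷ x))))
      + ∑splits n (λ a b → + binom a b * ∑ (cube m) (λ x → H a b (F∘addUnit (false ∷ x))))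
  ≡⟨ cong₂ _+_ (regroup (λ x → true ∷ x)) (regroup (λ x → false ∷ x)) ⟩
    ∑ (cube m) (λ x → G (true ∷ x)) + ∑ (cube m) (λ x → G (false ∷ x))
  ≡⟨ sym (∑-cube-suc m G) ⟩
    ∑ (cube (suc m)) G
  ∎
  where
  open ≡-Reasoning
  F∘addUnit : Vec Bool (suc m) → (Vec Bool (suc m) → ℕ) → ℤ
  F∘addUnit y s = F (addUnit y s)
  H : ℕ → ℕ → ((Vec Bool (suc m) → ℕ) → ℤ) → ℤ
  H a b F′ = ∑comps m a (λ s₀ → ∑comps m b (λ s₁ → F′ (join s₀ s₁)))
  G : Vec Bool (suc m) → ℤ
  G y = ∑comps (suc m) n (F∘addUnit y)
  remove-from₁ : ∀ a b → H a (suc b) F ≡ ∑ (cube m) (λ x → H a b (F∘addUnit (true ∷ x)))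
  remove-from₁ a b =
    trans (∑comps-cong m a (λ s₀ → ∑comps-suc m b (λ s₁ → F (join s₀ s₁)) (extensional-join₁ F ext s₀)))
    (trans (∑comps-∑ m a (cube m) (λ x s₀ → ∑comps m b (λ s₁ → F (join s₀ (addUnit x s₁)))))
      (∑-cong (cube m) (λ x → ∑comps-cong m a (λ s₀ → ∑comps-cong m b (λ s₁ →
        ext _ _ (join-addUnit-true x s₀ s₁))))))
  remove-from₀ : ∀ a b → H (suc a) b F ≡ ∑ (cube m) (λ x → H a b (F∘addUnit (false ∷ x)))
  remove-from₀ a b =
    trans (∑comps-suc m a (λ s₀ → ∑comps m b (λ s₁ → F (join s₀ s₁))) (extensional-∑comps F ext b))
      (∑-cong (cube m) (λ x → ∑comps-cong m a (λ s₀ → ∑comps-cong m b (λ s₁ →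
        ext _ _ (join-addUnit-false x s₀ s₁)))))
  regroup : (y : Vec Bool m → Vec Bool (suc m)) →
    ∑splits n (λ a b → + binom a b * ∑ (cube m) (λ x → H a b (F∘addUnit (y x))))
    ≡ ∑ (cube m) (λ x → G (y x))
  regroup y =
    trans (∑splits-cong n (λ a b → sym (∑-*ˡ (cube m) (+ binom a b) (λ x → H a b (F∘addUnit (y x))))))
    (trans (∑splits-∑ n (cube m) (λ x a b → + binom a b * H a b (F∘addUnit (y x))))
      (∑-cong (cube m) (λ x → sym (∑comps-suc-dim m n (F∘addUnit (y x)) (extensional-addUnit F ext (y x))))))

∑words≡∑comps : ∀ m n (F : (Vec Bool m → ℕ) → ℤ) → Extensional F → ∑words m n F ≡ ∑comps m n F
∑words≡∑comps m zero    F ext = trans (ℤP.+-identityʳ _) (sym (∑comps-zero m F ext))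
∑words≡∑comps m (suc n) F ext = begin
    ∑words m (suc n) F
  ≡⟨ ∑-allVecs-suc (cube m) n (λ E → F (counts E)) ⟩
    ∑ (cube m) (λ x → ∑words m n (λ s → F (addUnit x s)))
  ≡⟨ ∑-cong (cube m) (λ x → ∑words≡∑comps m n (λ s → F (addUnit x s)) (extensional-addUnit F ext x)) ⟩
    ∑ (cube m) (λ x → ∑comps m n (λ s → F (addUnit x s)))
  ≡⟨ sym (∑comps-suc m n F ext) ⟩
    ∑comps m (suc n) F
  ∎
  where open ≡-Reasoning

-- Reduced Latin rectangles as rows under the identity row

-- A missed x could be punched out of the range, giving an injection Fin (suc n) → Fin n.
fin-injective⇒onto : ∀ n (f : Fin n → Fin n) → (∀ i j → f i ≡ f j → i ≡ j) → ∀ x → ∃ λ j → f j ≡ x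
fin-injective⇒onto n f inj x with any? (λ j → f j ≟F x)
... | yes hit = hit
fin-injective⇒onto (suc n) f inj x | no miss = contradiction (injective⇒≤ punched-injective) (ℕP.<-irrefl refl)
  where
  punched : Fin (suc n) → Fin n
  punched j = Fin.punchOut {i = x} (λ eq → miss (j , sym eq))
  punched-injective : ∀ {i j} → punched i ≡ punched j → i ≡ j
  punched-injective {i} {j} eq = inj i j (punchOut-injective (λ e → miss (i , sym e)) (λ e → miss (j , sym e)) eq)

-- A right inverse of an onto endomap of Fin n is injective, hence onto, hence a two-sided inverse.
fin-onto⇒injective : ∀ n (f : Fin n → Fin n) → (∀ x → ∃ λ j → f j ≡ x) → ∀ i j → f i ≡ f j → i ≡ j
fin-onto⇒injective n f onto i j eq
  with fin-injective⇒onto n section section-injective i | fin-injective⇒onto n section section-injective j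
  where
  section : Fin n → Fin n
  section x = proj₁ (onto x)
  section-injective : ∀ x y → section x ≡ section y → x ≡ y
  section-injective x y e = trans (sym (proj₂ (onto x))) (trans (cong f e) (proj₂ (onto y)))
... | (x , refl) | (y , refl) = cong (λ z → proj₁ (onto z)) x≡y
  where
  x≡y : x ≡ y
  x≡y = trans (sym (proj₂ (onto x))) (trans eq (proj₂ (onto y)))

fresh⇒∉ : ∀ {n m} (y : Fin n) (c : Vec (Fin n) m) → T (fresh y c) → ∀ i → y ≢ lookup c i
fresh⇒∉ y (z ∷ c) t i eq with y ≟F z
fresh⇒∉ y (z ∷ c) t Fin.zero    eq | no y≢z = y≢z eq
fresh⇒∉ y (z ∷ c) t (Fin.suc i) eq | no _   = fresh⇒∉ y c t i eq

∉⇒fresh : ∀ {n m} (y : Fin n) (c : Vec (Fin n) m) → (∀ i → y ≢ lookup c i) → T (fresh y c)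
∉⇒fresh y []      ∉ = _
∉⇒fresh y (z ∷ c) ∉ with y ≟F z
... | yes y≡z = ∉ Fin.zero y≡z
... | no _    = ∉⇒fresh y c (λ i → ∉ (Fin.suc i))

distinct⇒injective : ∀ {n m} (c : Vec (Fin n) m) → T (distinct c) → ∀ i i′ → lookup c i ≡ lookup c i′ → i ≡ i′
distinct⇒injective (y ∷ c) t i i′ eq with Equivalence.to (T-∧ {fresh y c} {distinct c}) t
distinct⇒injective (y ∷ c) t Fin.zero    Fin.zero     eq | _         = refl
distinct⇒injective (y ∷ c) t Fin.zero    (Fin.suc i′) eq | tf , _    = contradiction eq (fresh⇒∉ y c tf i′)
distinct⇒injective (y ∷ c) t (Fin.suc i) Fin.zero     eq | tf , _    = contradiction (sym eq) (fresh⇒∉ y c tf i)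
distinct⇒injective (y ∷ c) t (Fin.suc i) (Fin.suc i′) eq | _  , td   = cong Fin.suc (distinct⇒injective c td i i′ eq)

injective⇒distinct : ∀ {n m} (c : Vec (Fin n) m) → (∀ i i′ → lookup c i ≡ lookup c i′ → i ≡ i′) → T (distinct c)
injective⇒distinct []      inj = _
injective⇒distinct (y ∷ c) inj = Equivalence.from (T-∧ {fresh y c} {distinct c})
  ( ∉⇒fresh y c (λ i eq → 0≢suc (inj Fin.zero (Fin.suc i) eq))
  , injective⇒distinct c (λ i i′ eq → suc-injective (inj (Fin.suc i) (Fin.suc i′) eq)) )
  where
  0≢suc : ∀ {n} {i : Fin n} → Fin.zero ≢ Fin.suc i
  0≢suc ()

column : ∀ {n m} → Fin n → Vec (Vec (Fin n) n) m → Vec (Fin n) m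
column j rows = Vec.map (λ r → lookup r j) rows

ColumnsFresh RowsOnto : ∀ {n m} → Vec (Vec (Fin n) n) m → Set
ColumnsFresh rows = ∀ j → T (distinct (j ∷ column j rows))
RowsOnto {n} {m} rows = ∀ (i : Fin m) (x : Fin n) → ∃ λ j → lookup (lookup rows i) j ≡ x

latinUnderId? : ∀ {n m} (rows : Vec (Vec (Fin n) n) m) → Dec (ColumnsFresh rows × RowsOnto rows)
latinUnderId? rows = all? (λ j → T? (distinct (j ∷ column j rows)))
               ×-dec all? (λ i → all? (λ x → any? (λ j → lookup (lookup rows i) j ≟F x)))

column-entry : ∀ {n m} (rows : Vec (Vec (Fin n) n) m) j i →
               lookup (j ∷ column j rows) i ≡ entry (Vec.allFin n ∷ rows) i j
column-entry {n} rows j Fin.zero    = sym (lookup-allFin j)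
column-entry     rows j (Fin.suc i) = lookup-map i (λ r → lookup r j) rows

reducedLatin⇔ : ∀ {n m} (r₀ : Vec (Fin n) n) (rows : Vec (Vec (Fin n) n) m) →
                IsReducedLatin (r₀ ∷ rows) ⇔ (r₀ ≡ Vec.allFin n × (ColumnsFresh rows × RowsOnto rows))
reducedLatin⇔ {n} {m} r₀ rows = mk⇔ to from
  where
  to : IsReducedLatin (r₀ ∷ rows) → r₀ ≡ Vec.allFin n × (ColumnsFresh rows × RowsOnto rows)
  to ((rowsDistinct , colsDistinct) , firstRowId) with trans (sym (tabulate∘lookup r₀)) (tabulate-cong firstRowId)
  ... | refl = refl
             , (λ j → injective⇒distinct (j ∷ column j rows) (λ i i′ eq →
                  colsDistinct j i i′ (trans (sym (column-entry rows j i)) (trans eq (column-entry rows j i′)))))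
             , (λ i → fin-injective⇒onto n (lookup (lookup rows i)) (rowsDistinct (Fin.suc i)))
  from : r₀ ≡ Vec.allFin n × (ColumnsFresh rows × RowsOnto rows) → IsReducedLatin (r₀ ∷ rows)
  from (refl , fresh , onto) = (rowsDistinct , colsDistinct) , lookup-allFin
    where
    rowsDistinct : RowsDistinct (Vec.allFin n ∷ rows)
    rowsDistinct Fin.zero    j j′ eq = trans (sym (lookup-allFin j)) (trans eq (lookup-allFin j′))
    rowsDistinct (Fin.suc i) = fin-onto⇒injective n (lookup (lookup rows i)) (onto i)
    colsDistinct : ColsDistinct (Vec.allFin n ∷ rows)
    colsDistinct j i i′ eq = distinct⇒injective (j ∷ column j rows) (fresh j) i i′
      (trans (column-entry rows j i) (trans eq (sym (column-entry rows j i′))))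

length-filter : ∀ {a p} {A : Set a} {P : A → Set p} (P? : ∀ x → Dec (P x)) (xs : List A) →
                + length (filter P? xs) ≡ ∑ xs (λ x → ⟦ does (P? x) ⟧)
length-filter P? []       = refl
length-filter P? (x ∷ xs) with does (P? x)
... | true  = trans (ℤP.pos-+ 1 (length (filter P? xs))) (cong (_+_ (+ 1)) (length-filter P? xs))
... | false = trans (length-filter P? xs) (sym (ℤP.+-identityˡ _))

R≡∑latinUnderId : ∀ m n →
  + R (suc m) n ≡ ∑ (allVecs (allVecs (allFin n) n) m) (λ rows → ⟦ does (latinUnderId? rows) ⟧)
R≡∑latinUnderId m n = begin
    + R (suc m) n
  ≡⟨ length-filter isReducedLatin? (allMatrices (suc m) n) ⟩
    ∑ (allVecs rowsL (suc m)) (λ L → ⟦ does (isReducedLatin? L) ⟧)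
  ≡⟨ ∑-allVecs-suc rowsL m (λ L → ⟦ does (isReducedLatin? L) ⟧) ⟩
    ∑ rowsL (λ r₀ → ∑ (allVecs rowsL m) (λ rows → ⟦ does (isReducedLatin? (r₀ ∷ rows)) ⟧))
  ≡⟨ ∑-cong rowsL (λ r₀ → ∑-cong (allVecs rowsL m) (λ rows →
       trans (cong ⟦_⟧ (does-⇔ (reducedLatin⇔ r₀ rows) (isReducedLatin? (r₀ ∷ rows))
                                 (≡-dec _≟F_ r₀ (Vec.allFin n) ×-dec latinUnderId? rows)))
             (⟦∧⟧ (does (≡-dec _≟F_ r₀ (Vec.allFin n))) _))) ⟩
    ∑ rowsL (λ r₀ → ∑ (allVecs rowsL m) (λ rows → ⟦ does (≡-dec _≟F_ r₀ (Vec.allFin n)) ⟧ * latin rows))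
  ≡⟨ ∑-cong rowsL (λ r₀ → ∑-*ˡ (allVecs rowsL m) ⟦ does (≡-dec _≟F_ r₀ (Vec.allFin n)) ⟧ latin) ⟩
    ∑ rowsL (λ r₀ → ⟦ does (≡-dec _≟F_ r₀ (Vec.allFin n)) ⟧ * ∑ (allVecs rowsL m) latin)
  ≡⟨ allVecs-enumerates (allFin-enumerates n) n (λ _ → ∑ (allVecs rowsL m) latin) (Vec.allFin n) ⟩
    ∑ (allVecs rowsL m) latin
  ∎
  where
  open ≡-Reasoning
  rowsL = allVecs (allFin n) n
  latin : Vec (Vec (Fin n) n) m → ℤ
  latin rows = ⟦ does (latinUnderId? rows) ⟧

⟦all?⟧ : ∀ n {p} {P : Fin n → Set p} (P? : ∀ i → Dec (P i)) →
         ⟦ does (all? P?) ⟧ ≡ ∏ᶠ n (λ i → ⟦ does (P? i) ⟧)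
⟦all?⟧ zero    P? = refl
⟦all?⟧ (suc n) P? =
  trans (⟦∧⟧ (does (P? Fin.zero)) _) (cong (⟦ does (P? Fin.zero) ⟧ *_) (⟦all?⟧ n (λ i → P? (Fin.suc i))))

⟦not-any?⟧ : ∀ n {p} {P : Fin n → Set p} (P? : ∀ i → Dec (P i)) →
             ⟦ not (does (any? P?)) ⟧ ≡ ∏ᶠ n (λ i → ⟦ not (does (P? i)) ⟧)
⟦not-any?⟧ zero    P? = refl
⟦not-any?⟧ (suc n) P? =
  trans (⟦not∨⟧ (does (P? Fin.zero)) _) (cong (⟦ not (does (P? Fin.zero)) ⟧ *_) (⟦not-any?⟧ n (λ i → P? (Fin.suc i))))

missing : ∀ {n m} → Vec (Vec (Fin n) n) m → Fin m → Fin n → ℤ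
missing {n} rows i x = ∏ᶠ n (λ j → ⟦ not (does (lookup (lookup rows i) j ≟F x)) ⟧)

⟦latinUnderId⟧ : ∀ {n m} (rows : Vec (Vec (Fin n) n) m) →
  ⟦ does (latinUnderId? rows) ⟧
  ≡ ∏ᶠ n (λ j → ⟦ distinct (j ∷ column j rows) ⟧) * ∏ᶠ m (λ i → ∏ᶠ n (λ x → + 1 - missing rows i x))
⟦latinUnderId⟧ {n} {m} rows =
  trans (⟦∧⟧ (does (all? (λ j → T? (distinct (j ∷ column j rows))))) _)
    (cong₂ _*_ (⟦all?⟧ n (λ j → T? (distinct (j ∷ column j rows))))
      (trans (⟦all?⟧ m _) (∏ᶠ-cong m (λ i → trans (⟦all?⟧ n _) (∏ᶠ-cong n (λ x →
        trans (⟦⟧≡1-⟦not⟧ _) (cong (λ z → + 1 - z) (⟦not-any?⟧ n (λ j → lookup (lookup rows i) j ≟F x)))))))))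

avoids-∏ᶠ : ∀ {n m} (τ : Fin n → Vec Bool m) (c : Vec (Fin n) m) →
            avoids τ c ≡ ∏ᶠ m (λ i → ⟦ not (lookup (τ (lookup c i)) i) ⟧)
avoids-∏ᶠ τ []      = refl
avoids-∏ᶠ τ (y ∷ c) = cong₂ _*_ (cong (λ b → ⟦ not b ⟧) (head-lookup (τ y)))
  (trans (avoids-∏ᶠ (λ x → Vec.tail (τ x)) c)
         (∏ᶠ-cong _ (λ i → cong (λ b → ⟦ not b ⟧) (tail-lookup (τ (lookup c i)) i))))
  where
  head-lookup : ∀ {m} (v : Vec Bool (suc m)) → Vec.head v ≡ lookup v Fin.zero
  head-lookup (x ∷ v) = refl
  tail-lookup : ∀ {m} (v : Vec Bool (suc m)) i → lookup (Vec.tail v) i ≡ lookup v (Fin.suc i)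
  tail-lookup (x ∷ v) i = refl

if-const : ∀ b (u : ℤ) → (if b then u else u) ≡ u
if-const true  u = refl
if-const false u = refl

∏ᶠ-implies-≢ : ∀ n (p : Fin n → Bool) (y : Fin n) →
               ∏ᶠ n (λ x → if p x then ⟦ not (does (y ≟F x)) ⟧ else + 1) ≡ ⟦ not (p y) ⟧
∏ᶠ-implies-≢ (suc n) p Fin.zero = begin
    (if p Fin.zero then + 0 else + 1) * ∏ᶠ n (λ x → if p (Fin.suc x) then + 1 else + 1)
  ≡⟨ cong ((if p Fin.zero then + 0 else + 1) *_) (trans (∏ᶠ-cong n (λ x → if-const (p (Fin.suc x)) (+ 1))) (∏ᶠ-one n)) ⟩
    (if p Fin.zero then + 0 else + 1) * + 1
  ≡⟨ trans (ℤP.*-identityʳ _) (if-⟦not⟧ (p Fin.zero)) ⟩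
    ⟦ not (p Fin.zero) ⟧
  ∎
  where
  open ≡-Reasoning
  if-⟦not⟧ : ∀ b → (if b then + 0 else + 1) ≡ ⟦ not b ⟧
  if-⟦not⟧ true  = refl
  if-⟦not⟧ false = refl
∏ᶠ-implies-≢ (suc n) p (Fin.suc y) =
  trans (cong (_* ∏ᶠ n (λ x → if p (Fin.suc x) then ⟦ not (does (y ≟F x)) ⟧ else + 1)) (if-const (p Fin.zero) (+ 1)))
        (trans (ℤP.*-identityˡ _) (∏ᶠ-implies-≢ n (λ x → p (Fin.suc x)) y))

if-∏ᶠ : ∀ n (b : Bool) (h : Fin n → ℤ) → (if b then ∏ᶠ n h else + 1) ≡ ∏ᶠ n (λ j → if b then h j else + 1)
if-∏ᶠ n true  h = refl
if-∏ᶠ n false h = sym (∏ᶠ-one n)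

-- E x marks the rows declared to miss the letter x; regrouped by columns this says
-- that no entry of column j is a letter x whose E x marks that row.
∏ᶠ-missing-columns : ∀ {n m} (E : Vec (Vec Bool m) n) (rows : Vec (Vec (Fin n) n) m) →
  ∏ᶠ n (λ x → ∏ᶠ m (λ i → if lookup (lookup E x) i then missing rows i x else + 1))
  ≡ ∏ᶠ n (λ j → avoids (lookup E) (column j rows))
∏ᶠ-missing-columns {n} {m} E rows = begin
    ∏ᶠ n (λ x → ∏ᶠ m (λ i → if lookup (lookup E x) i then missing rows i x else + 1))
  ≡⟨ ∏ᶠ-cong n (λ x → ∏ᶠ-cong m (λ i → if-∏ᶠ n (lookup (lookup E x) i) _)) ⟩
    ∏ᶠ n (λ x → ∏ᶠ m (λ i → ∏ᶠ n (λ j → X x i j)))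
  ≡⟨ ∏ᶠ-cong n (λ x → ∏ᶠ-comm m n (λ i j → X x i j)) ⟩
    ∏ᶠ n (λ x → ∏ᶠ n (λ j → ∏ᶠ m (λ i → X x i j)))
  ≡⟨ ∏ᶠ-comm n n (λ x j → ∏ᶠ m (λ i → X x i j)) ⟩
    ∏ᶠ n (λ j → ∏ᶠ n (λ x → ∏ᶠ m (λ i → X x i j)))
  ≡⟨ ∏ᶠ-cong n (λ j → ∏ᶠ-comm n m (λ x i → X x i j)) ⟩
    ∏ᶠ n (λ j → ∏ᶠ m (λ i → ∏ᶠ n (λ x → X x i j)))
  ≡⟨ ∏ᶠ-cong n (λ j → ∏ᶠ-cong m (λ i →
       trans (∏ᶠ-implies-≢ n (λ x → lookup (lookup E x) i) (lookup (lookup rows i) j))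
             (cong (λ y → ⟦ not (lookup (lookup E y) i) ⟧) (sym (lookup-map i (λ r → lookup r j) rows))))) ⟩
    ∏ᶠ n (λ j → ∏ᶠ m (λ i → ⟦ not (lookup (lookup E (lookup (column j rows) i)) i) ⟧))
  ≡⟨ ∏ᶠ-cong n (λ j → sym (avoids-∏ᶠ (lookup E) (column j rows))) ⟩
    ∏ᶠ n (λ j → avoids (lookup E) (column j rows))
  ∎
  where
  open ≡-Reasoning
  X : Fin n → Fin m → Fin n → ℤ
  X x i j = if lookup (lookup E x) i then ⟦ not (does (lookup (lookup rows i) j ≟F x)) ⟧ else + 1

sign : ∀ {m n} → Vec (Vec Bool m) n → ℤ
sign {n = n} E = ∏ᶠ n (λ x → -1ℤ ^ ones (lookup E x))

-- Inclusion–exclusion over the set E x of rows missing the letter x, for every x.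
∏ᶠ-rowsOnto : ∀ m n (rows : Vec (Vec (Fin n) n) m) →
  ∏ᶠ m (λ i → ∏ᶠ n (λ x → + 1 - missing rows i x))
  ≡ ∑ (allVecs (cube m) n) (λ E → sign E * ∏ᶠ n (λ j → avoids (lookup E) (column j rows)))
∏ᶠ-rowsOnto m n rows = begin
    ∏ᶠ m (λ i → ∏ᶠ n (λ x → + 1 - missing rows i x))
  ≡⟨ ∏ᶠ-comm m n (λ i x → + 1 - missing rows i x) ⟩
    ∏ᶠ n (λ x → ∏ᶠ m (λ i → + 1 - missing rows i x))
  ≡⟨ ∏ᶠ-cong n (λ x → ∏ᶠ-one-minus m (λ i → missing rows i x)) ⟩
    ∏ᶠ n (λ x → ∑ (cube m) (λ ε → -1ℤ ^ ones ε * ∏ᶠ m (λ i → if lookup ε i then missing rows i x else + 1)))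
  ≡⟨ sym (∑-allVecs-∏ᶠ (cube m) n
           (λ x ε → -1ℤ ^ ones ε * ∏ᶠ m (λ i → if lookup ε i then missing rows i x else + 1))) ⟩
    ∑ (allVecs (cube m) n) (λ E → ∏ᶠ n (λ x → -1ℤ ^ ones (lookup E x) * Y E x))
  ≡⟨ ∑-cong (allVecs (cube m) n) (λ E → trans (∏ᶠ-distrib-* n _ (Y E)) (cong (sign E *_) (∏ᶠ-missing-columns E rows))) ⟩
    ∑ (allVecs (cube m) n) (λ E → sign E * ∏ᶠ n (λ j → avoids (lookup E) (column j rows)))
  ∎
  where
  open ≡-Reasoning
  Y : Vec (Vec Bool m) n → Fin n → ℤ
  Y E x = ∏ᶠ m (λ i → if lookup (lookup E x) i then missing rows i x else + 1)

-- Column j of a reduced rectangle starts with j, so j is excluded from the rest of it.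
blockLetter : ∀ {n m} → Fin n → (Fin n → Vec Bool m) → Fin n → Vec Bool m
blockLetter j τ x = if does (j ≟F x) then 𝟏 else τ x

avoids-cong : ∀ {n m} {τ τ′ : Fin n → Vec Bool m} → (∀ x → τ x ≡ τ′ x) → ∀ c → avoids τ c ≡ avoids τ′ c
avoids-cong e []      = refl
avoids-cong e (y ∷ c) = cong₂ (λ v r → ⟦ not (Vec.head v) ⟧ * r) (e y) (avoids-cong (λ x → cong Vec.tail (e x)) c)

avoids-blockLetter : ∀ {n m} (j : Fin n) (τ : Fin n → Vec Bool m) (c : Vec (Fin n) m) →
                     ⟦ fresh j c ⟧ * avoids τ c ≡ avoids (blockLetter j τ) c
avoids-blockLetter j τ []      = refl
avoids-blockLetter j τ (y ∷ c) with j ≟F y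
... | yes _ = refl
... | no _  = begin
    ⟦ fresh j c ⟧ * (⟦ not (Vec.head (τ y)) ⟧ * avoids τ′ c)
  ≡⟨ solve 3 (λ f a v → f :* (a :* v) := a :* (f :* v)) refl ⟦ fresh j c ⟧ ⟦ not (Vec.head (τ y)) ⟧ (avoids τ′ c) ⟩
    ⟦ not (Vec.head (τ y)) ⟧ * (⟦ fresh j c ⟧ * avoids τ′ c)
  ≡⟨ cong (⟦ not (Vec.head (τ y)) ⟧ *_)
       (trans (avoids-blockLetter j τ′ c) (avoids-cong (λ x → tail-if (does (j ≟F x)) (τ x)) c)) ⟩
    ⟦ not (Vec.head (τ y)) ⟧ * avoids (λ x → Vec.tail (blockLetter j τ x)) c
  ∎
  where
  open ≡-Reasoning
  τ′ = λ x → Vec.tail (τ x)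
  tail-if : ∀ {m} b (v : Vec Bool (suc m)) → (if b then 𝟏 else Vec.tail v) ≡ Vec.tail (if b then 𝟏 else v)
  tail-if true  v = refl
  tail-if false v = refl

∑-column-injAvoiding : ∀ {n m} (E : Vec (Vec Bool m) n) (j : Fin n) →
  ∑ (allVecs (allFin n) m) (λ c → ⟦ distinct (j ∷ c) ⟧ * avoids (lookup E) c) ≡ injAvoiding m (blockLetter j (lookup E))
∑-column-injAvoiding {n} {m} E j = ∑-cong (allVecs (allFin n) m) (λ c → begin
    ⟦ fresh j c ∧ distinct c ⟧ * avoids (lookup E) c
  ≡⟨ cong (_* avoids (lookup E) c) (⟦∧⟧ (fresh j c) (distinct c)) ⟩
    ⟦ fresh j c ⟧ * ⟦ distinct c ⟧ * avoids (lookup E) c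
  ≡⟨ solve 3 (λ f d v → f :* d :* v := d :* (f :* v)) refl ⟦ fresh j c ⟧ ⟦ distinct c ⟧ (avoids (lookup E) c) ⟩
    ⟦ distinct c ⟧ * (⟦ fresh j c ⟧ * avoids (lookup E) c)
  ≡⟨ cong (⟦ distinct c ⟧ *_) (avoids-blockLetter j (lookup E) c) ⟩
    ⟦ distinct c ⟧ * avoids (blockLetter j (lookup E)) c
  ∎)
  where open ≡-Reasoning

∑-latinUnderId : ∀ m n →
  ∑ (allVecs (allVecs (allFin n) n) m) (λ rows → ⟦ does (latinUnderId? rows) ⟧)
  ≡ ∑ (allVecs (cube m) n) (λ E → sign E * ∏ᶠ n (λ j → injAvoiding m (blockLetter j (lookup E))))
∑-latinUnderId m n = begin
    ∑ matrices (λ rows → ⟦ does (latinUnderId? rows) ⟧)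
  ≡⟨ ∑-cong matrices (λ rows → trans (⟦latinUnderId⟧ rows) (trans (cong (D rows *_) (∏ᶠ-rowsOnto m n rows))
       (trans (sym (∑-*ˡ patterns (D rows) _)) (∑-cong patterns (λ E → regroup E rows))))) ⟩
    ∑ matrices (λ rows → ∑ patterns (λ E → sign E * ∏ᶠ n (λ j → W E j (column j rows))))
  ≡⟨ ∑-comm matrices patterns (λ rows E → sign E * ∏ᶠ n (λ j → W E j (column j rows))) ⟩
    ∑ patterns (λ E → ∑ matrices (λ rows → sign E * ∏ᶠ n (λ j → W E j (column j rows))))
  ≡⟨ ∑-cong patterns (λ E → trans (∑-*ˡ matrices (sign E) _) (cong (sign E *_)
       (trans (∑-allVecs-columns (allFin n) n m (W E)) (∏ᶠ-cong n (∑-column-injAvoiding E))))) ⟩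
    ∑ patterns (λ E → sign E * ∏ᶠ n (λ j → injAvoiding m (blockLetter j (lookup E))))
  ∎
  where
  open ≡-Reasoning
  matrices = allVecs (allVecs (allFin n) n) m
  patterns = allVecs (cube m) n
  D : Vec (Vec (Fin n) n) m → ℤ
  D rows = ∏ᶠ n (λ j → ⟦ distinct (j ∷ column j rows) ⟧)
  W : Vec (Vec Bool m) n → Fin n → Vec (Fin n) m → ℤ
  W E j c = ⟦ distinct (j ∷ c) ⟧ * avoids (lookup E) c
  regroup : ∀ E rows → D rows * (sign E * ∏ᶠ n (λ j → avoids (lookup E) (column j rows)))
                       ≡ sign E * ∏ᶠ n (λ j → W E j (column j rows))
  regroup E rows = trans (solve 3 (λ d s a → d :* (s :* a) := s :* (d :* a)) refl (D rows) (sign E) _)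
                         (cong (sign E *_) (sym (∏ᶠ-distrib-* n _ _)))

-- The right-hand side as a sum over words of forbidden patterns

shift≡ : ∀ {m} (s : Vec Bool m → ℕ) ε δ →
         shift s ε δ ≡ (+ s δ - ⟦ does (δ ≟ᶜ ε) ⟧) + ⟦ does (δ ≟ᶜ 𝟏) ⟧
shift≡ s ε δ with δ ≟ᶜ ε | δ ≟ᶜ 𝟏
... | yes _ | yes _ = refl
... | yes _ | no _  = refl
... | no _  | yes _ = refl
... | no _  | no _  = refl

counts-∑ᶠ : ∀ {m n} (E : Vec (Vec Bool m) n) δ → + counts E δ ≡ ∑ᶠ n (λ x → ⟦ does (δ ≟ᶜ lookup E x) ⟧)
counts-∑ᶠ []      δ = refl
counts-∑ᶠ (y ∷ E) δ = trans (ℤP.pos-+ (𝟙 (does (δ ≟ᶜ y))) (counts E δ))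
                            (cong (_+_ ⟦ does (δ ≟ᶜ y) ⟧) (counts-∑ᶠ E δ))

shift-counts : ∀ {m n} (E : Vec (Vec Bool m) n) j δ →
               shift (counts E) (lookup E j) δ ≡ ∑ᶠ n (λ x → ⟦ does (δ ≟ᶜ blockLetter j (lookup E) x) ⟧)
shift-counts {m} {n} E j δ = begin
    shift (counts E) (lookup E j) δ
  ≡⟨ trans (shift≡ (counts E) (lookup E j) δ) (cong (λ S → (S - a j) + b) (counts-∑ᶠ E δ)) ⟩
    (∑ᶠ n a - a j) + b
  ≡⟨ solve 3 (λ S aⱼ b → (S :- aⱼ) :+ b := S :+ (b :- aⱼ)) refl (∑ᶠ n a) (a j) b ⟩
    ∑ᶠ n a + (b - a j)
  ≡⟨ cong (_+_ (∑ᶠ n a)) (sym (∑ᶠ-pick n (λ x → b - a x) j)) ⟩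
    ∑ᶠ n a + ∑ᶠ n (λ x → ⟦ does (x ≟F j) ⟧ * (b - a x))
  ≡⟨ sym (∑ᶠ-distrib-+ n a _) ⟩
    ∑ᶠ n (λ x → a x + ⟦ does (x ≟F j) ⟧ * (b - a x))
  ≡⟨ ∑ᶠ-cong n pointwise ⟩
    ∑ᶠ n (λ x → ⟦ does (δ ≟ᶜ blockLetter j (lookup E) x) ⟧)
  ∎
  where
  open ≡-Reasoning
  a : Fin n → ℤ
  a x = ⟦ does (δ ≟ᶜ lookup E x) ⟧
  b : ℤ
  b = ⟦ does (δ ≟ᶜ 𝟏) ⟧
  pointwise : ∀ x → a x + ⟦ does (x ≟F j) ⟧ * (b - a x) ≡ ⟦ does (δ ≟ᶜ blockLetter j (lookup E) x) ⟧
  pointwise x rewrite does-⇔ (mk⇔ sym sym) (x ≟F j) (j ≟F x) with does (j ≟F x)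
  ... | true  = solve 2 (λ a b → a :+ con (+ 1) :* (b :- a) := b) refl (a x) b
  ... | false = solve 2 (λ a b → a :+ con (+ 0) :* (b :- a) := a) refl (a x) b

f-shift-counts : ∀ {m n} (E : Vec (Vec Bool m) n) j B →
                 f B (shift (counts E) (lookup E j)) ≡ allowedOn (blockLetter j (lookup E)) B
f-shift-counts {m} {n} E j B = begin
    ∑ (cube m) (λ δ → if ZeroOn B δ then shift (counts E) (lookup E j) δ else + 0)
  ≡⟨ ∑-cong (cube m) (λ δ → trans (if-then-0 (ZeroOn B δ) _) (cong (⟦ ZeroOn B δ ⟧ *_) (shift-counts E j δ))) ⟩
    ∑ (cube m) (λ δ → ⟦ ZeroOn B δ ⟧ * ∑ᶠ n (λ x → ⟦ does (δ ≟ᶜ τ x) ⟧))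
  ≡⟨ ∑-cong (cube m) (λ δ → trans (sym (∑ᶠ-*ˡ n ⟦ ZeroOn B δ ⟧ _))
                                  (∑ᶠ-cong n (λ x → ℤP.*-comm ⟦ ZeroOn B δ ⟧ _))) ⟩
    ∑ (cube m) (λ δ → ∑ᶠ n (λ x → ⟦ does (δ ≟ᶜ τ x) ⟧ * ⟦ ZeroOn B δ ⟧))
  ≡⟨ ∑-∑ᶠ-comm (cube m) n (λ δ x → ⟦ does (δ ≟ᶜ τ x) ⟧ * ⟦ ZeroOn B δ ⟧) ⟩
    ∑ᶠ n (λ x → ∑ (cube m) (λ δ → ⟦ does (δ ≟ᶜ τ x) ⟧ * ⟦ ZeroOn B δ ⟧))
  ≡⟨ ∑ᶠ-cong n (λ x → cube-enumerates m (λ δ → ⟦ ZeroOn B δ ⟧) (τ x)) ⟩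
    allowedOn τ B
  ∎
  where
  open ≡-Reasoning
  τ = blockLetter j (lookup E)

g-shift-counts : ∀ {m n} (E : Vec (Vec Bool m) n) j →
                 g (shift (counts E) (lookup E j)) ≡ injAvoiding m (blockLetter j (lookup E))
g-shift-counts {m} E j = trans (partitionSum-cong m (f-shift-counts E j)) (sym (injAvoiding≡partitionSum m _))

^-distribʳ-* : ∀ x y c → (x * y) ^ c ≡ x ^ c * y ^ c
^-distribʳ-* x y zero    = refl
^-distribʳ-* x y (suc c) = trans (cong (x * y *_) (^-distribʳ-* x y c))
  (solve 4 (λ x y u v → (x :* y) :* (u :* v) := (x :* u) :* (y :* v)) refl x y (x ^ c) (y ^ c))

^-* : ∀ i a c → i ^ (a ℕ.* c) ≡ (i ^ a) ^ c
^-* i zero    c = sym (ℤP.^-zeroˡ c)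
^-* i (suc a) c = trans (ℤP.^-distribˡ-+-* i c (a ℕ.* c))
  (trans (cong (i ^ c *_) (^-* i a c)) (sym (^-distribʳ-* i (i ^ a) c)))

^-sum : ∀ {a} {A : Set a} (i : ℤ) (h : A → ℕ) xs → i ^ sumℕ (map h xs) ≡ ∏ xs (λ x → i ^ h x)
^-sum i h []       = refl
^-sum i h (x ∷ xs) = trans (ℤP.^-distribˡ-+-* i (h x) _) (cong (i ^ h x *_) (^-sum i h xs))

∏-cube-counts : ∀ {m n} (h : Vec Bool m → ℤ) (E : Vec (Vec Bool m) n) →
                ∏ (cube m) (λ ε → h ε ^ counts E ε) ≡ ∏ᶠ n (λ j → h (lookup E j))
∏-cube-counts {m} h []      = ∏-one (cube m)
∏-cube-counts {m} h (y ∷ E) = begin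
    ∏ (cube m) (λ ε → h ε ^ (𝟙 (does (ε ≟ᶜ y)) ℕ.+ counts E ε))
  ≡⟨ ∏-cong (cube m) (λ ε → ℤP.^-distribˡ-+-* (h ε) (𝟙 (does (ε ≟ᶜ y))) (counts E ε)) ⟩
    ∏ (cube m) (λ ε → h ε ^ 𝟙 (does (ε ≟ᶜ y)) * h ε ^ counts E ε)
  ≡⟨ ∏-distrib-* (cube m) (λ ε → h ε ^ 𝟙 (does (ε ≟ᶜ y))) (λ ε → h ε ^ counts E ε) ⟩
    ∏ (cube m) (λ ε → h ε ^ 𝟙 (does (ε ≟ᶜ y))) * ∏ (cube m) (λ ε → h ε ^ counts E ε)
  ≡⟨ cong₂ _*_ (∏-cube-pick m h y) (∏-cube-counts h E) ⟩
    h y * ∏ᶠ _ (λ j → h (lookup E j))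
  ∎
  where open ≡-Reasoning

rhsTerm : ∀ m → (Vec Bool m → ℕ) → ℤ
rhsTerm m s = -1ℤ ^ sumℕ (map (λ ε → ones ε ℕ.* s ε) (cube m)) * ∏ (cube m) (λ ε → g (shift s ε) ^ s ε)

rhs≡∑comps : ∀ m n → rhs m n ≡ ∑comps m n (rhsTerm m)
rhs≡∑comps m n = ∑-cong (comps m n) (λ s →
  solve 3 (λ σ M P → (σ :* M) :* P := M :* (σ :* P)) refl
    (-1ℤ ^ sumℕ (map (λ ε → ones ε ℕ.* s ε) (cube m))) (+ multinomial n s) (∏ (cube m) (λ ε → g (shift s ε) ^ s ε)))

rhsTerm-extensional : ∀ m → Extensional (rhsTerm m)
rhsTerm-extensional m s s′ e = cong₂ _*_
  (cong (λ xs → -1ℤ ^ sumℕ xs) (LP.map-cong (λ ε → cong (ones ε ℕ.*_) (e ε)) (cube m)))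
  (∏-cong (cube m) (λ ε → cong₂ _^_ (partitionSum-cong m (λ B → ∑-cong (cube m) (λ δ →
     cong (λ z → if ZeroOn B δ then z else + 0) (shift-cong ε δ)))) (e ε)))
  where
  shift-cong : ∀ ε δ → shift s ε δ ≡ shift s′ ε δ
  shift-cong ε δ = trans (shift≡ s ε δ)
    (trans (cong (λ k → (+ k - ⟦ does (δ ≟ᶜ ε) ⟧) + ⟦ does (δ ≟ᶜ 𝟏) ⟧) (e δ)) (sym (shift≡ s′ ε δ)))

rhsTerm-counts : ∀ m n (E : Vec (Vec Bool m) n) →
                 rhsTerm m (counts E) ≡ sign E * ∏ᶠ n (λ j → injAvoiding m (blockLetter j (lookup E)))
rhsTerm-counts m n E = cong₂ _*_ sign-counts
  (trans (∏-cube-counts (λ ε → g (shift (counts E) ε)) E) (∏ᶠ-cong n (g-shift-counts E)))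
  where
  sign-counts : -1ℤ ^ sumℕ (map (λ ε → ones ε ℕ.* counts E ε) (cube m)) ≡ sign E
  sign-counts = trans (^-sum -1ℤ (λ ε → ones ε ℕ.* counts E ε) (cube m))
    (trans (∏-cong (cube m) (λ ε → ^-* -1ℤ (ones ε) (counts E ε)))
           (∏-cube-counts (λ ε → -1ℤ ^ ones ε) E))

mainTheorem1 : (k n : ℕ) → 2 ≤ k → 1 ≤ n →
    (+ R k n) ≡ rhs (k Data.Nat.∸ 1) n
mainTheorem1 (suc zero) n (ℕ.s≤s ()) _
mainTheorem1 (suc (suc m′)) n _ _ = begin
    + R (suc m) n
  ≡⟨ R≡∑latinUnderId m n ⟩
    ∑ (allVecs (allVecs (allFin n) n) m) (λ rows → ⟦ does (latinUnderId? rows) ⟧)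
  ≡⟨ ∑-latinUnderId m n ⟩
    ∑ (allVecs (cube m) n) (λ E → sign E * ∏ᶠ n (λ j → injAvoiding m (blockLetter j (lookup E))))
  ≡⟨ ∑-cong (allVecs (cube m) n) (λ E → sym (rhsTerm-counts m n E)) ⟩
    ∑words m n (rhsTerm m)
  ≡⟨ ∑words≡∑comps m n (rhsTerm m) (rhsTerm-extensional m) ⟩
    ∑comps m n (rhsTerm m)
  ≡⟨ sym (rhs≡∑comps m n) ⟩
    rhs m n
  ∎
  where
  open ≡-Reasoning
  m = suc m′
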